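{- Let $C$ be an even self-dual $L$-code of length $n$. Then there is a polynomial $F(X_1,X_2,X_3)$, weighted homogeneous of weighted degree $n$ with respect to the weights $1,2,3$ of $X_1,X_2,X_3$, such that $$\mathrm{swe}_C(x,y,z)=F\bigl(x+z,\ x^2+y^2+2z^2,\ x^3+3xz^2+3y^2z+z^3\bigr).$$
   Context: Let $L=\{0,1,\omega,\bar\omega\}$ be the Klein four-group $\mathbf{Z}_2\times\mathbf{Z}_2$. Define $|0|^2=0$, $|1|^2=1$, $|\omega|^2=|\bar\omega|^2=2$, $q(x)=|x|^2\bmod 2$, and the dot product $x\cdot y=q(x+y)-q(x)-q(y)\in\mathbf{F}_2$ (so $x\cdot y=1$ iff $x,y$ are distinct and nonzero). On $L^n$: $(\mathbf{x},\mathbf{y})=\sum_i x_i\cdot y_i$ and $\mathrm{ewt}(\mathbf{x})=\sum_i|x_i|^2$. An $L$-code of length $n$ is a subgroup $C\subseteq L^n$; it is self-dual if $C=\{\mathbf{x}:(\mathbf{x},\mathbf{y})=0\ \forall\mathbf{y}\in C\}$ and even if all codewords have even Euclidean weight. The symmetrized weight enumerator is $\mathrm{swe}_C(x,y,z)=\sum_{\mathbf{c}\in C}x^{n_0(\mathbf{c})}y^{n_1(\mathbf{c})}z^{n_2(\mathbf{c})}$, with $n_0,n_1,n_2$ the numbers of coordinates equal to $0$, to $1$, and to $\omega$ or $\bar\omega$. -}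

module Defs where

open import Data.Nat as ℕ using (ℕ; zero; suc)
open import Data.Nat.Divisibility using (_∣_)
open import Data.Bool using (Bool; true; false; _xor_; if_then_else_)
open import Data.Vec using (Vec; []; _∷_; replicate; zipWith)
open import Data.List as List using (List; []; _∷_; concatMap; filter; map)
open import Data.Product using (_×_; _,_)
open import Data.Rational as ℚ using (ℚ; 0ℚ; 1ℚ)
open import Relation.Binary.PropositionalEquality using (_≡_)
open import Data.List.Relation.Unary.All using (All)
open import Data.Bool.Properties using (T?)
open import Relation.Nullary using (Dec)
import Data.Integer

-- The Klein four-group L = {0, 1, ω, ω̄}

data L : Set where
  o : L
  e : L
  ω : L
  ω̄ : L

_⊕_ : L → L → L
o ⊕ y = y
x ⊕ o = x
e ⊕ e = o
e ⊕ ω = ω̄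
e ⊕ ω̄ = ω
ω ⊕ e = ω̄
ω ⊕ ω = o
ω ⊕ ω̄ = e
ω̄ ⊕ e = ω
ω̄ ⊕ ω = e
ω̄ ⊕ ω̄ = o

norm² : L → ℕ
norm² o = 0
norm² e = 1
norm² ω = 2
norm² ω̄ = 2

-- q(x) = |x|^2 mod 2, as an element of F2 = Bool
q : L → Bool
q o = false
q e = true
q ω = false
q ω̄ = false

-- x · y = q(x+y) - q(x) - q(y)  in F2 (subtraction = xor in F2)
_·_ : L → L → Bool
x · y = q (x ⊕ y) xor q x xor q y

_⊕ᵛ_ : ∀ {n} → Vec L n → Vec L n → Vec L n
_⊕ᵛ_ = zipWith _⊕_

0ᵛ : ∀ {n} → Vec L n
0ᵛ = replicate _ o

⟨_,_⟩ : ∀ {n} → Vec L n → Vec L n → Bool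
⟨ [] , [] ⟩ = false
⟨ x ∷ xs , y ∷ ys ⟩ = (x · y) xor ⟨ xs , ys ⟩

ewt : ∀ {n} → Vec L n → ℕ
ewt [] = 0
ewt (x ∷ xs) = norm² x ℕ.+ ewt xs

-- L-codes: a code of length n is given by its (decidable) membership
-- predicate  C : Vec L n → Bool  (c ∈ C  iff  C c ≡ true).

Code : ℕ → Set
Code n = Vec L n → Bool

_∈C_ : ∀ {n} → Vec L n → Code n → Set
c ∈C C = C c ≡ true

IsSubgroup : ∀ {n} → Code n → Set
IsSubgroup {n} C = (0ᵛ ∈C C) × (∀ (x y : Vec L n) → x ∈C C → y ∈C C → (x ⊕ᵛ y) ∈C C)

-- L-code = subgroup; self-dual: C = C^⊥
record IsSelfDual {n} (C : Code n) : Set where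
  field
    subgroup : IsSubgroup C
    inDual   : ∀ (x y : Vec L n) → x ∈C C → y ∈C C → ⟨ x , y ⟩ ≡ false
    dualIn   : ∀ (x : Vec L n) → (∀ (y : Vec L n) → y ∈C C → ⟨ x , y ⟩ ≡ false) → x ∈C C

IsEven : ∀ {n} → Code n → Set
IsEven {n} C = ∀ (x : Vec L n) → x ∈C C → 2 ∣ ewt x

allL : List L
allL = o ∷ e ∷ ω ∷ ω̄ ∷ []

allVecs : (n : ℕ) → List (Vec L n)
allVecs zero = [] ∷ []
allVecs (suc n) = concatMap (λ a → map (a ∷_) (allVecs n)) allL

codewords : ∀ {n} → Code n → List (Vec L n)
codewords {n} C = filter (λ c → T? (C c)) (allVecs n)

_^_ : ℚ → ℕ → ℚ
x ^ zero = 1ℚ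
x ^ suc k = x ℚ.* (x ^ k)

sumℚ : List ℚ → ℚ
sumℚ = List.foldr ℚ._+_ 0ℚ

fromℕ : ℕ → ℚ
fromℕ k = Data.Integer.+ k ℚ./ 1

n₀ n₁ n₂ : ∀ {n} → Vec L n → ℕ
n₀ [] = 0
n₀ (x ∷ xs) = (case0 x) ℕ.+ n₀ xs
  where case0 : L → ℕ
        case0 o = 1
        case0 _ = 0
n₁ [] = 0
n₁ (x ∷ xs) = (case1 x) ℕ.+ n₁ xs
  where case1 : L → ℕ
        case1 e = 1
        case1 _ = 0
n₂ [] = 0
n₂ (x ∷ xs) = (case2 x) ℕ.+ n₂ xs
  where case2 : L → ℕ
        case2 ω = 1
        case2 ω̄ = 1
        case2 _ = 0

-- symmetrized weight enumerator, as a polynomial function on ℚ³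
swe : ∀ {n} → Code n → ℚ → ℚ → ℚ → ℚ
swe C x y z = sumℚ (map (λ c → (x ^ n₀ c) ℚ.* ((y ^ n₁ c) ℚ.* (z ^ n₂ c))) (codewords C))

-- polynomials in X1, X2, X3 with rational coefficients, given as a
-- finite list of terms  coeff · X1^a X2^b X3^d

Term : Set
Term = ℚ × ℕ × ℕ × ℕ

Poly3 : Set
Poly3 = List Term

evalTerm : Term → ℚ → ℚ → ℚ → ℚ
evalTerm (c , a , b , d) X₁ X₂ X₃ = c ℚ.* ((X₁ ^ a) ℚ.* ((X₂ ^ b) ℚ.* (X₃ ^ d)))

eval : Poly3 → ℚ → ℚ → ℚ → ℚ
eval F X₁ X₂ X₃ = sumℚ (map (λ t → evalTerm t X₁ X₂ X₃) F)

wdeg : Term → ℕ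
wdeg (_ , a , b , d) = a ℕ.+ 2 ℕ.* b ℕ.+ 3 ℕ.* d

WeightedHomogeneous : ℕ → Poly3 → Set
WeightedHomogeneous n F = All (λ t → wdeg t ≡ n) F

-- Write W C x y z = Σ_v [v ∈ C] Π_i t(v_i) with t(0) = x, t(1) = y,
-- t(ω) = t(ω̄) = z; this is swe C.  The proof combines three facts.
--  * MacWilliams: Fourier analysis on Lⁿ and self-duality give
--    W(x+y+2z, x+y−2z, x−y) = |C|·W(x,y,z), and |C| = 2ⁿ.
--  * Evenness: codewords have an even number of 1's, so W(x,−y,z) = W(x,y,z).
--  * Substituting x = 2a+b+c, y = b−c, z = b+c turns W into a homogeneous
--    polynomial W' of degree n, symmetric in b,c by evenness and in a,b by
--    MacWilliams and homogeneity; by the fundamental theorem on symmetric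
--    polynomials W' = G(e₁,e₂,e₃) with G weighted homogeneous of degree n.
-- Inverting the substitution, each eᵢ is a polynomial Fᵢ of weighted degree i
-- in the three invariants g₁, g₂, g₃ of the statement; F = G(F₁,F₂,F₃).

module Submission where

open import Defs
open import Data.Nat as ℕ using (ℕ; zero; suc; s≤s; z≤n)
import Data.Nat.Properties as ℕP
open import Data.Nat.Divisibility using (_∣_; ∣m+n∣m⇒∣n; ∣1⇒≡1; m∣m*n)
open import Data.Nat.Tactic.RingSolver using (solve-∀)
open import Data.Rational as ℚ using (ℚ; _+_; _*_; -_; _-_; 0ℚ; 1ℚ; ½)
import Data.Rational.Properties as ℚP
import Data.Integer as ℤ
open import Data.List using (List; []; _∷_; _++_; map; filter)
open import Data.List.Relation.Unary.All as All using (All; []; _∷_)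
import Data.List.Relation.Unary.All.Properties as AllP
open import Data.Vec using (Vec; []; _∷_)
open import Data.Bool as Bool using (Bool; true; false; _xor_; _∧_)
open import Data.Bool.Properties using (T?; xor-∧-commutativeRing)
open import Algebra.Bundles using (CommutativeRing)
open import Algebra.Properties.CommutativeSemigroup (CommutativeRing.+-commutativeSemigroup xor-∧-commutativeRing)
  renaming (interchange to xor-interchange)
open import Data.Product using (Σ; _×_; _,_; proj₁; proj₂)
open import Data.Empty using (⊥; ⊥-elim)
open import Data.Sum using (_⊎_; inj₁; inj₂)
open import Relation.Nullary using (¬_; Dec; yes; no)
open import Relation.Binary using (tri<; tri≈; tri>)
open import Relation.Nullary.Decidable using (map′; toWitness)
open import Relation.Binary.PropositionalEquality
import Data.Rational.Solver as ℚSolver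
open ℚSolver.+-*-Solver using (solve; _:=_; con; _:+_; _:*_; :-_; _:-_; _:^_; Polynomial)

cong₃ : ∀ (f : ℚ → ℚ → ℚ → ℚ) {x x' y y' z z'} → x ≡ x' → y ≡ y' → z ≡ z' → f x y z ≡ f x' y' z'
cong₃ f refl refl refl = refl

^-+ : ∀ x m k → x ^ (m ℕ.+ k) ≡ x ^ m * x ^ k
^-+ x zero    k = sym (ℚP.*-identityˡ (x ^ k))
^-+ x (suc m) k = trans (cong (x *_) (^-+ x m k)) (sym (ℚP.*-assoc x (x ^ m) (x ^ k)))

^-* : ∀ x y k → (x * y) ^ k ≡ x ^ k * y ^ k
^-* x y zero    = refl
^-* x y (suc k) = trans (cong ((x * y) *_) (^-* x y k))
  (solve 4 (λ x y a b → (x :* y) :* (a :* b) := (x :* a) :* (y :* b)) refl x y (x ^ k) (y ^ k))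

-- The solver expression of a concrete polynomial applied to three solver
-- expressions; its denotation is definitionally the evaluation of the
-- polynomial, so the ring solver can normalise evaluations of explicit
-- polynomials.
⟪_⟫ : ∀ {m} → Poly3 → Polynomial m → Polynomial m → Polynomial m → Polynomial m
⟪ [] ⟫                 A B C = con 0ℚ
⟪ (c , a , b , d) ∷ P ⟫ A B C = con c :* ((A :^ a) :* ((B :^ b) :* (C :^ d))) :+ ⟪ P ⟫ A B C

eval-++ : ∀ P Q x y z → eval (P ++ Q) x y z ≡ eval P x y z + eval Q x y z
eval-++ []      Q x y z = sym (ℚP.+-identityˡ (eval Q x y z))
eval-++ (t ∷ P) Q x y z = trans (cong (evalTerm t x y z +_) (eval-++ P Q x y z))
  (sym (ℚP.+-assoc (evalTerm t x y z) (eval P x y z) (eval Q x y z)))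

eval-map : ∀ (f : Term → Term) k {x y z x' y' z'} →
  (∀ t → evalTerm (f t) x y z ≡ k * evalTerm t x' y' z') →
  ∀ P → eval (map f P) x y z ≡ k * eval P x' y' z'
eval-map f k h []      = sym (ℚP.*-zeroʳ k)
eval-map f k {x' = x'} {y'} {z'} h (t ∷ P) =
  trans (cong₂ _+_ (h t) (eval-map f k h P)) (sym (ℚP.*-distribˡ-+ k (evalTerm t x' y' z') (eval P x' y' z')))

scaleP : ℚ → Poly3 → Poly3
scaleP k = map (λ { (c , a , b , d) → (k * c , a , b , d) })

eval-scaleP : ∀ k P x y z → eval (scaleP k P) x y z ≡ k * eval P x y z
eval-scaleP k P x y z = eval-map _ k {x' = x} {y' = y} {z' = z} (λ { (c , a , b , d) → ℚP.*-assoc k c _ }) P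

_-ₚ_ : Poly3 → Poly3 → Poly3
P -ₚ Q = P ++ scaleP (- 1ℚ) Q

eval-−ₚ : ∀ P Q x y z → eval (P -ₚ Q) x y z ≡ eval P x y z - eval Q x y z
eval-−ₚ P Q x y z = trans (eval-++ P _ x y z) (trans (cong (eval P x y z +_) (eval-scaleP (- 1ℚ) Q x y z))
  (solve 2 (λ p q → p :+ con (- 1ℚ) :* q := p :- q) refl (eval P x y z) (eval Q x y z)))

mulT : Term → Term → Term
mulT (c , a , b , d) (c' , a' , b' , d') = (c * c' , a ℕ.+ a' , b ℕ.+ b' , d ℕ.+ d')

eval-mulT : ∀ s t x y z → evalTerm (mulT s t) x y z ≡ evalTerm s x y z * evalTerm t x y z
eval-mulT (c , a , b , d) (c' , a' , b' , d') x y z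
  rewrite ^-+ x a a' | ^-+ y b b' | ^-+ z d d' =
  solve 8 (λ c c' p p' q q' r r' → (c :* c') :* ((p :* p') :* ((q :* q') :* (r :* r')))
            := (c :* (p :* (q :* r))) :* (c' :* (p' :* (q' :* r')))) refl
          c c' (x ^ a) (x ^ a') (y ^ b) (y ^ b') (z ^ d) (z ^ d')

mulP : Poly3 → Poly3 → Poly3
mulP []      Q = []
mulP (s ∷ P) Q = map (mulT s) Q ++ mulP P Q

eval-mulP : ∀ P Q x y z → eval (mulP P Q) x y z ≡ eval P x y z * eval Q x y z
eval-mulP []      Q x y z = sym (ℚP.*-zeroˡ (eval Q x y z))
eval-mulP (s ∷ P) Q x y z = begin
  eval (map (mulT s) Q ++ mulP P Q) x y z               ≡⟨ eval-++ (map (mulT s) Q) _ x y z ⟩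
  eval (map (mulT s) Q) x y z + eval (mulP P Q) x y z   ≡⟨ cong₂ _+_ (eval-map (mulT s) (evalTerm s x y z) {x' = x} {y' = y} {z' = z} (λ t → eval-mulT s t x y z) Q)
                                                                      (eval-mulP P Q x y z) ⟩
  evalTerm s x y z * eval Q x y z + eval P x y z * eval Q x y z
                                        ≡⟨ sym (ℚP.*-distribʳ-+ (eval Q x y z) (evalTerm s x y z) (eval P x y z)) ⟩
  eval (s ∷ P) x y z * eval Q x y z                     ∎
  where open ≡-Reasoning

powP : Poly3 → ℕ → Poly3
powP P zero    = (1ℚ , 0 , 0 , 0) ∷ []
powP P (suc k) = mulP P (powP P k)

eval-powP : ∀ P k x y z → eval (powP P k) x y z ≡ eval P x y z ^ k
eval-powP P zero    x y z = refl
eval-powP P (suc k) x y z = trans (eval-mulP P (powP P k) x y z) (cong (eval P x y z *_) (eval-powP P k x y z))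

substP : Poly3 → Poly3 → Poly3 → Poly3 → Poly3
substP []                  A B C = []
substP ((k , a , b , d) ∷ G) A B C = scaleP k (mulP (powP A a) (mulP (powP B b) (powP C d))) ++ substP G A B C

eval-substP : ∀ G A B C x y z →
  eval (substP G A B C) x y z ≡ eval G (eval A x y z) (eval B x y z) (eval C x y z)
eval-substP []                  A B C x y z = refl
eval-substP ((k , a , b , d) ∷ G) A B C x y z
  rewrite eval-++ (scaleP k (mulP (powP A a) (mulP (powP B b) (powP C d)))) (substP G A B C) x y z
        | eval-scaleP k (mulP (powP A a) (mulP (powP B b) (powP C d))) x y z
        | eval-mulP (powP A a) (mulP (powP B b) (powP C d)) x y z
        | eval-mulP (powP B b) (powP C d) x y z
        | eval-powP A a x y z | eval-powP B b x y z | eval-powP C d x y z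
        | eval-substP G A B C x y z = refl

degW : ℕ → ℕ → ℕ → Term → ℕ
degW w₁ w₂ w₃ (_ , a , b , d) = w₁ ℕ.* a ℕ.+ w₂ ℕ.* b ℕ.+ w₃ ℕ.* d

WHomog : ℕ → ℕ → ℕ → ℕ → Poly3 → Set
WHomog w₁ w₂ w₃ n P = All (λ t → degW w₁ w₂ w₃ t ≡ n) P

private
  degW-+ : ∀ w₁ w₂ w₃ a b d a' b' d' →
    w₁ ℕ.* (a ℕ.+ a') ℕ.+ w₂ ℕ.* (b ℕ.+ b') ℕ.+ w₃ ℕ.* (d ℕ.+ d')
      ≡ (w₁ ℕ.* a ℕ.+ w₂ ℕ.* b ℕ.+ w₃ ℕ.* d) ℕ.+ (w₁ ℕ.* a' ℕ.+ w₂ ℕ.* b' ℕ.+ w₃ ℕ.* d')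
  degW-+ = solve-∀

  degW-subst : ∀ a b d v₁ v₂ v₃ → a ℕ.* v₁ ℕ.+ (b ℕ.* v₂ ℕ.+ d ℕ.* v₃) ≡ v₁ ℕ.* a ℕ.+ v₂ ℕ.* b ℕ.+ v₃ ℕ.* d
  degW-subst = solve-∀

module _ {w₁ w₂ w₃ : ℕ} where

  WHomog-map : ∀ {n} (f : Term → Term) → (∀ t → degW w₁ w₂ w₃ (f t) ≡ degW w₁ w₂ w₃ t) →
    ∀ P → WHomog w₁ w₂ w₃ n P → WHomog w₁ w₂ w₃ n (map f P)
  WHomog-map f h P hP = AllP.map⁺ (All.map (λ {t} ht → trans (h t) ht) hP)

  WHomog-scaleP : ∀ {n} k P → WHomog w₁ w₂ w₃ n P → WHomog w₁ w₂ w₃ n (scaleP k P)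
  WHomog-scaleP k = WHomog-map _ (λ t → refl)

  WHomog-mulP : ∀ {m k} P Q → WHomog w₁ w₂ w₃ m P → WHomog w₁ w₂ w₃ k Q →
    WHomog w₁ w₂ w₃ (m ℕ.+ k) (mulP P Q)
  WHomog-mulP []                    Q []       hQ = []
  WHomog-mulP ((c , a , b , d) ∷ P) Q (h ∷ hP) hQ =
    AllP.++⁺ (AllP.map⁺ (All.map (λ { {(_ , a' , b' , d')} h' → trans (degW-+ w₁ w₂ w₃ a b d a' b' d') (cong₂ ℕ._+_ h h') }) hQ))
             (WHomog-mulP P Q hP hQ)

  WHomog-powP : ∀ {m} P k → WHomog w₁ w₂ w₃ m P → WHomog w₁ w₂ w₃ (k ℕ.* m) (powP P k)
  WHomog-powP P zero    h = trans (cong₂ ℕ._+_ (cong₂ ℕ._+_ (ℕP.*-zeroʳ w₁) (ℕP.*-zeroʳ w₂)) (ℕP.*-zeroʳ w₃)) refl ∷ []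
  WHomog-powP P (suc k) h = WHomog-mulP P (powP P k) h (WHomog-powP P k h)

  WHomog-substP : ∀ {v₁ v₂ v₃ n} G A B C → WHomog v₁ v₂ v₃ n G →
    WHomog w₁ w₂ w₃ v₁ A → WHomog w₁ w₂ w₃ v₂ B → WHomog w₁ w₂ w₃ v₃ C →
    WHomog w₁ w₂ w₃ n (substP G A B C)
  WHomog-substP [] A B C [] hA hB hC = []
  WHomog-substP {v₁} {v₂} {v₃} ((k , a , b , d) ∷ G) A B C (h ∷ hG) hA hB hC =
    AllP.++⁺ (subst (λ m → WHomog w₁ w₂ w₃ m _) (trans (degW-subst a b d v₁ v₂ v₃) h)
               (WHomog-scaleP k _ (WHomog-mulP (powP A a) _ (WHomog-powP A a hA)
                 (WHomog-mulP (powP B b) _ (WHomog-powP B b hB) (WHomog-powP C d hC)))))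
             (WHomog-substP G A B C hG hA hB hC)

-- Hom k n P says that every term of P has total degree
-- n − k (stated as k + deg t ≡ n): P arises from a homogeneous polynomial
-- of degree n by dividing out k variables.

deg : Term → ℕ
deg = degW 1 1 1

Hom : ℕ → ℕ → Poly3 → Set
Hom k n P = All (λ t → k ℕ.+ deg t ≡ n) P

Hom-scaleP : ∀ {n} k P → Hom 0 n P → Hom 0 n (scaleP k P)
Hom-scaleP = WHomog-scaleP {1} {1} {1}

Hom-map : ∀ {k n} (f : Term → Term) → (∀ t → deg (f t) ≡ deg t) → ∀ P → Hom k n P → Hom k n (map f P)
Hom-map {k} f h P hP = AllP.map⁺ (All.map (λ {t} ht → trans (cong (k ℕ.+_) (h t)) ht) hP)

Hom-empty : ∀ {k n} P → Hom k n P → n ℕ.< k → P ≡ []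
Hom-empty []      []       lt = refl
Hom-empty {k} (t ∷ P) (h ∷ hP) lt =
  ⊥-elim (ℕP.<-irrefl refl (ℕP.≤-<-trans (subst (k ℕ.≤_) h (ℕP.m≤m+n k (deg t))) lt))

Hom-shift : ∀ {k m} P → Hom k (k ℕ.+ m) P → Hom 0 m P
Hom-shift {k} P hP = All.map (λ {t} h → ℕP.+-cancelˡ-≡ k (deg t) _ h) hP

eval-Hom-scale : ∀ {n} P → Hom 0 n P → ∀ s x y z → eval P (s * x) (s * y) (s * z) ≡ s ^ n * eval P x y z
eval-Hom-scale {n} []      []       s x y z = sym (ℚP.*-zeroʳ (s ^ n))
eval-Hom-scale {n} ((c , a , b , d) ∷ P) (h ∷ hP) s x y z =
  trans (cong₂ _+_ term (eval-Hom-scale P hP s x y z)) (sym (ℚP.*-distribˡ-+ (s ^ n) _ _))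
  where
  total : 1 ℕ.* a ℕ.+ 1 ℕ.* b ℕ.+ 1 ℕ.* d ≡ a ℕ.+ b ℕ.+ d
  total = cong₂ ℕ._+_ (cong₂ ℕ._+_ (ℕP.*-identityˡ a) (ℕP.*-identityˡ b)) (ℕP.*-identityˡ d)
  term : evalTerm (c , a , b , d) (s * x) (s * y) (s * z) ≡ s ^ n * evalTerm (c , a , b , d) x y z
  term rewrite ^-* s x a | ^-* s y b | ^-* s z d | sym (trans (sym total) h) | ^-+ s (a ℕ.+ b) d | ^-+ s a b =
    solve 7 (λ c sa sb sd xa yb zd → c :* ((sa :* xa) :* ((sb :* yb) :* (sd :* zd)))
       := ((sa :* sb) :* sd) :* (c :* (xa :* (yb :* zd)))) refl c (s ^ a) (s ^ b) (s ^ d) (x ^ a) (y ^ b) (z ^ d)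

swap₁₂ swap₂₃ swap₁₃ : Poly3 → Poly3
swap₁₂ = map λ { (c , a , b , d) → (c , b , a , d) }
swap₂₃ = map λ { (c , a , b , d) → (c , a , d , b) }
swap₁₃ = map λ { (c , a , b , d) → (c , d , b , a) }

eval-swap₁₂ : ∀ P x y z → eval (swap₁₂ P) x y z ≡ eval P y x z
eval-swap₁₂ P x y z = trans (eval-map _ 1ℚ {x' = y} {y' = x} {z' = z} (λ { (c , a , b , d) →
    solve 4 (λ c p q r → c :* (p :* (q :* r)) := con 1ℚ :* (c :* (q :* (p :* r)))) refl c (x ^ b) (y ^ a) (z ^ d) }) P)
  (ℚP.*-identityˡ _)

eval-swap₂₃ : ∀ P x y z → eval (swap₂₃ P) x y z ≡ eval P x z y
eval-swap₂₃ P x y z = trans (eval-map _ 1ℚ {x' = x} {y' = z} {z' = y} (λ { (c , a , b , d) →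
    solve 4 (λ c p q r → c :* (p :* (q :* r)) := con 1ℚ :* (c :* (p :* (r :* q)))) refl c (x ^ a) (y ^ d) (z ^ b) }) P)
  (ℚP.*-identityˡ _)

eval-swap₁₃ : ∀ P x y z → eval (swap₁₃ P) x y z ≡ eval P z y x
eval-swap₁₃ P x y z = trans (eval-map _ 1ℚ {x' = z} {y' = y} {z' = x} (λ { (c , a , b , d) →
    solve 4 (λ c p q r → c :* (p :* (q :* r)) := con 1ℚ :* (c :* (r :* (q :* p)))) refl c (x ^ d) (y ^ b) (z ^ a) }) P)
  (ℚP.*-identityˡ _)

private
  deg-swap₁₂ : ∀ a b d → 1 ℕ.* b ℕ.+ 1 ℕ.* a ℕ.+ 1 ℕ.* d ≡ 1 ℕ.* a ℕ.+ 1 ℕ.* b ℕ.+ 1 ℕ.* d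
  deg-swap₁₂ = solve-∀
  deg-swap₂₃ : ∀ a b d → 1 ℕ.* a ℕ.+ 1 ℕ.* d ℕ.+ 1 ℕ.* b ≡ 1 ℕ.* a ℕ.+ 1 ℕ.* b ℕ.+ 1 ℕ.* d
  deg-swap₂₃ = solve-∀
  deg-swap₁₃ : ∀ a b d → 1 ℕ.* d ℕ.+ 1 ℕ.* b ℕ.+ 1 ℕ.* a ≡ 1 ℕ.* a ℕ.+ 1 ℕ.* b ℕ.+ 1 ℕ.* d
  deg-swap₁₃ = solve-∀

Hom-swap₁₂ : ∀ {k n} P → Hom k n P → Hom k n (swap₁₂ P)
Hom-swap₁₂ {k} = Hom-map {k} _ λ { (c , a , b , d) → deg-swap₁₂ a b d }

Hom-swap₂₃ : ∀ {k n} P → Hom k n P → Hom k n (swap₂₃ P)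
Hom-swap₂₃ {k} = Hom-map {k} _ λ { (c , a , b , d) → deg-swap₂₃ a b d }

Hom-swap₁₃ : ∀ {k n} P → Hom k n P → Hom k n (swap₁₃ P)
Hom-swap₁₃ {k} = Hom-map {k} _ λ { (c , a , b , d) → deg-swap₁₃ a b d }

div₃ : Poly3 → Poly3
div₃ []                        = []
div₃ ((c , a , b , zero) ∷ P)  = div₃ P
div₃ ((c , a , b , suc d) ∷ P) = (c , a , b , d) ∷ div₃ P

split₃ : ∀ P x y z → eval P x y z ≡ eval P x y 0ℚ + z * eval (div₃ P) x y z
split₃ [] x y z = sym (trans (ℚP.+-identityˡ _) (ℚP.*-zeroʳ z))
split₃ ((c , a , b , zero) ∷ P) x y z rewrite split₃ P x y z =
  solve 3 (λ t p q → t :+ (p :+ q) := (t :+ p) :+ q) refl (c * (x ^ a * (y ^ b * 1ℚ))) (eval P x y 0ℚ) (z * eval (div₃ P) x y z)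
split₃ ((c , a , b , suc d) ∷ P) x y z rewrite split₃ P x y z =
  solve 8 (λ c p q r z p0 s w → c :* (p :* (q :* (z :* r))) :+ (p0 :+ z :* s)
     := (c :* (p :* (q :* (con 0ℚ :* w))) :+ p0) :+ z :* (c :* (p :* (q :* r)) :+ s))
     refl c (x ^ a) (y ^ b) (z ^ d) z (eval P x y 0ℚ) (eval (div₃ P) x y z) (0ℚ ^ d)

Hom-div₃ : ∀ {k n} P → Hom k n P → Hom (suc k) n (div₃ P)
Hom-div₃ []                        []       = []
Hom-div₃ {k} ((c , a , b , zero) ∷ P)  (h ∷ hP) = Hom-div₃ {k} P hP
Hom-div₃ {k} ((c , a , b , suc d) ∷ P) (h ∷ hP) = trans (shift k a b d) h ∷ Hom-div₃ {k} P hP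
  where
  shift : ∀ k a b d → suc k ℕ.+ (1 ℕ.* a ℕ.+ 1 ℕ.* b ℕ.+ 1 ℕ.* d) ≡ k ℕ.+ (1 ℕ.* a ℕ.+ 1 ℕ.* b ℕ.+ 1 ℕ.* suc d)
  shift = solve-∀

div₂ div₁ : Poly3 → Poly3
div₂ P = swap₂₃ (div₃ (swap₂₃ P))
div₁ P = swap₁₃ (div₃ (swap₁₃ P))

split₂ : ∀ P x y z → eval P x y z ≡ eval P x 0ℚ z + y * eval (div₂ P) x y z
split₂ P x y z = begin
  eval P x y z                                          ≡⟨ sym (eval-swap₂₃ P x z y) ⟩
  eval (swap₂₃ P) x z y                                 ≡⟨ split₃ (swap₂₃ P) x z y ⟩
  eval (swap₂₃ P) x z 0ℚ + y * eval (div₃ (swap₂₃ P)) x z y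
                          ≡⟨ cong₂ (λ u v → u + y * v) (eval-swap₂₃ P x z 0ℚ) (sym (eval-swap₂₃ (div₃ (swap₂₃ P)) x y z)) ⟩
  eval P x 0ℚ z + y * eval (div₂ P) x y z               ∎
  where open ≡-Reasoning

split₁ : ∀ P x y z → eval P x y z ≡ eval P 0ℚ y z + x * eval (div₁ P) x y z
split₁ P x y z = begin
  eval P x y z                                          ≡⟨ sym (eval-swap₁₃ P z y x) ⟩
  eval (swap₁₃ P) z y x                                 ≡⟨ split₃ (swap₁₃ P) z y x ⟩
  eval (swap₁₃ P) z y 0ℚ + x * eval (div₃ (swap₁₃ P)) z y x
                          ≡⟨ cong₂ (λ u v → u + x * v) (eval-swap₁₃ P z y 0ℚ) (sym (eval-swap₁₃ (div₃ (swap₁₃ P)) x y z)) ⟩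
  eval P 0ℚ y z + x * eval (div₁ P) x y z               ∎
  where open ≡-Reasoning

Hom-div₂ : ∀ {k n} P → Hom k n P → Hom (suc k) n (div₂ P)
Hom-div₂ {k} P hP = Hom-swap₂₃ {suc k} (div₃ (swap₂₃ P)) (Hom-div₃ {k} (swap₂₃ P) (Hom-swap₂₃ {k} P hP))

Hom-div₁ : ∀ {k n} P → Hom k n P → Hom (suc k) n (div₁ P)
Hom-div₁ {k} P hP = Hom-swap₁₃ {suc k} (div₃ (swap₁₃ P)) (Hom-div₃ {k} (swap₁₃ P) (Hom-swap₁₃ {k} P hP))

factor : ∀ {q q₀} v d → q ≡ q₀ + v * d → q₀ ≡ 0ℚ → q ≡ v * d
factor v d split q₀≡0 = trans split (trans (cong (_+ v * d) q₀≡0) (ℚP.+-identityˡ (v * d)))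

peel : ∀ {q q₀} u v d → q ≡ q₀ + v * d → u * q₀ ≡ 0ℚ → u * q ≡ u * (v * d)
peel {q₀ = q₀} u v d split uq₀≡0 =
  factor u (v * d) (trans (cong (u *_) split) (ℚP.*-distribˡ-+ u q₀ (v * d))) uq₀≡0

-- Dividing a symmetric polynomial by X₁X₂ (resp. X₁X₂X₃)
-- gives a quotient that is symmetric only where the divisor is nonzero;
-- averaging it over the permutations gives a symmetric quotient.

symmetrise₂ : Poly3 → Poly3
symmetrise₂ U = scaleP ½ (U ++ swap₁₂ U)

eval-symmetrise₂ : ∀ U x y z → eval (symmetrise₂ U) x y z ≡ ½ * (eval U x y z + eval U y x z)
eval-symmetrise₂ U x y z = trans (eval-scaleP ½ (U ++ swap₁₂ U) x y z)
  (cong (½ *_) (trans (eval-++ U (swap₁₂ U) x y z) (cong (eval U x y z +_) (eval-swap₁₂ U x y z))))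

Hom-symmetrise₂ : ∀ {m} U → Hom 0 m U → Hom 0 m (symmetrise₂ U)
Hom-symmetrise₂ U h = Hom-scaleP ½ _ (AllP.++⁺ h (Hom-swap₁₂ {0} U h))

symmetrise₂-quotient : ∀ (r : ℚ → ℚ → ℚ) U → (∀ a b → r a b ≡ r b a) →
  (∀ a b → r a b ≡ b * (a * eval U a b 0ℚ)) → ∀ a b → r a b ≡ (a * b) * eval (symmetrise₂ U) a b 0ℚ
symmetrise₂-quotient r U sym-r quot a b = sym (begin
  (a * b) * eval (symmetrise₂ U) a b 0ℚ   ≡⟨ cong ((a * b) *_) (eval-symmetrise₂ U a b 0ℚ) ⟩
  (a * b) * (½ * (u + u'))                 ≡⟨ solve 4 (λ a b u u' → (a :* b) :* (con ½ :* (u :+ u'))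
                                                  := con ½ :* (b :* (a :* u)) :+ con ½ :* (a :* (b :* u'))) refl a b u u' ⟩
  ½ * (b * (a * u)) + ½ * (a * (b * u'))  ≡⟨ cong₂ (λ p p' → ½ * p + ½ * p') (sym (quot a b)) (sym (quot b a)) ⟩
  ½ * r a b + ½ * r b a                   ≡⟨ cong (λ p → ½ * r a b + ½ * p) (sym (sym-r a b)) ⟩
  ½ * r a b + ½ * r a b                   ≡⟨ solve 1 (λ p → con ½ :* p :+ con ½ :* p := p) refl (r a b) ⟩
  r a b                                   ∎)
  where
  open ≡-Reasoning
  u  = eval U a b 0ℚ
  u' = eval U b a 0ℚ

sixth : ℚ
sixth = ℤ.+ 1 ℚ./ 6

symmetrise₃ : Poly3 → Poly3
symmetrise₃ U = scaleP sixth (U ++ (swap₁₂ U ++ (swap₂₃ U ++ (swap₁₃ U ++ (swap₁₂ (swap₂₃ U) ++ swap₂₃ (swap₁₂ U))))))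

orbitSum : Poly3 → ℚ → ℚ → ℚ → ℚ
orbitSum U x y z = eval U x y z + (eval U y x z + (eval U x z y + (eval U z y x + (eval U y z x + eval U z x y))))

eval-symmetrise₃ : ∀ U x y z → eval (symmetrise₃ U) x y z ≡ sixth * orbitSum U x y z
eval-symmetrise₃ U x y z = trans (eval-scaleP sixth L₁ x y z) (cong (sixth *_)
  (trans (eval-++ U L₂ x y z) (cong (eval U x y z +_)
  (trans (eval-++ (swap₁₂ U) L₃ x y z) (cong₂ _+_ (eval-swap₁₂ U x y z)
  (trans (eval-++ (swap₂₃ U) L₄ x y z) (cong₂ _+_ (eval-swap₂₃ U x y z)
  (trans (eval-++ (swap₁₃ U) L₅ x y z) (cong₂ _+_ (eval-swap₁₃ U x y z)
  (trans (eval-++ (swap₁₂ (swap₂₃ U)) (swap₂₃ (swap₁₂ U)) x y z)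
    (cong₂ _+_ (trans (eval-swap₁₂ (swap₂₃ U) x y z) (eval-swap₂₃ U y x z))
               (trans (eval-swap₂₃ (swap₁₂ U) x y z) (eval-swap₁₂ U x z y)))))))))))))
  where
  L₅ = swap₁₂ (swap₂₃ U) ++ swap₂₃ (swap₁₂ U)
  L₄ = swap₁₃ U ++ L₅
  L₃ = swap₂₃ U ++ L₄
  L₂ = swap₁₂ U ++ L₃
  L₁ = U ++ L₂

Hom-symmetrise₃ : ∀ {m} U → Hom 0 m U → Hom 0 m (symmetrise₃ U)
Hom-symmetrise₃ U h = Hom-scaleP sixth _ (AllP.++⁺ h (AllP.++⁺ (Hom-swap₁₂ {0} U h) (AllP.++⁺ (Hom-swap₂₃ {0} U h)
  (AllP.++⁺ (Hom-swap₁₃ {0} U h) (AllP.++⁺ (Hom-swap₁₂ {0} _ (Hom-swap₂₃ {0} U h)) (Hom-swap₂₃ {0} _ (Hom-swap₁₂ {0} U h)))))))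

symmetrise₃-swap₁₂ : ∀ U x y z → eval (symmetrise₃ U) x y z ≡ eval (symmetrise₃ U) y x z
symmetrise₃-swap₁₂ U x y z = trans (eval-symmetrise₃ U x y z) (trans (cong (sixth *_)
  (solve 6 (λ a b c d e f → a :+ (b :+ (c :+ (d :+ (e :+ f)))) := b :+ (a :+ (e :+ (f :+ (c :+ d))))) refl
     (eval U x y z) (eval U y x z) (eval U x z y) (eval U z y x) (eval U y z x) (eval U z x y)))
  (sym (eval-symmetrise₃ U y x z)))

symmetrise₃-swap₂₃ : ∀ U x y z → eval (symmetrise₃ U) x y z ≡ eval (symmetrise₃ U) x z y
symmetrise₃-swap₂₃ U x y z = trans (eval-symmetrise₃ U x y z) (trans (cong (sixth *_)
  (solve 6 (λ a b c d e f → a :+ (b :+ (c :+ (d :+ (e :+ f)))) := c :+ (f :+ (a :+ (e :+ (d :+ b))))) refl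
     (eval U x y z) (eval U y x z) (eval U x z y) (eval U z y x) (eval U y z x) (eval U z x y)))
  (sym (eval-symmetrise₃ U x z y)))

e₁ e₂ e₃ : ℚ → ℚ → ℚ → ℚ
e₁ a b c = a + (b + c)
e₂ a b c = a * b + (a * c + b * c)
e₃ a b c = a * (b * c)

symmetrise₃-quotient : ∀ (r : ℚ → ℚ → ℚ → ℚ) U →
  (∀ x y z → r x y z ≡ r y x z) → (∀ x y z → r x y z ≡ r x z y) →
  (∀ x y z → r x y z ≡ z * (y * (x * eval U x y z))) →
  ∀ x y z → r x y z ≡ e₃ x y z * eval (symmetrise₃ U) x y z
symmetrise₃-quotient r U s₁₂ s₂₃ quot x y z = sym (begin
  e₃ x y z * eval (symmetrise₃ U) x y z  ≡⟨ cong (e₃ x y z *_) (eval-symmetrise₃ U x y z) ⟩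
  x * (y * z) * (sixth * orbitSum U x y z)
    ≡⟨ solve 9 (λ x y z a b c d e f → x :* (y :* z) :* (con sixth :* (a :+ (b :+ (c :+ (d :+ (e :+ f))))))
          := con sixth :* ((z :* (y :* (x :* a))) :+ ((z :* (x :* (y :* b))) :+ ((y :* (z :* (x :* c)))
             :+ ((x :* (y :* (z :* d))) :+ ((x :* (z :* (y :* e))) :+ (y :* (x :* (z :* f)))))))))
          refl x y z (eval U x y z) (eval U y x z) (eval U x z y) (eval U z y x) (eval U y z x) (eval U z x y) ⟩
  sixth * (z * (y * (x * eval U x y z)) + (z * (x * (y * eval U y x z)) + (y * (z * (x * eval U x z y))
    + (x * (y * (z * eval U z y x)) + (x * (z * (y * eval U y z x)) + y * (x * (z * eval U z x y)))))))
    ≡⟨ cong (sixth *_) (cong₂ _+_ (sym (quot x y z)) (cong₂ _+_ (sym (quot y x z)) (cong₂ _+_ (sym (quot x z y))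
         (cong₂ _+_ (sym (quot z y x)) (cong₂ _+_ (sym (quot y z x)) (sym (quot z x y))))))) ⟩
  sixth * (r x y z + (r y x z + (r x z y + (r z y x + (r y z x + r z x y)))))
    ≡⟨ cong (sixth *_) (cong (r x y z +_) (cong₂ _+_ (sym (s₁₂ x y z)) (cong₂ _+_ (sym (s₂₃ x y z))
         (cong₂ _+_ r-zyx (cong₂ _+_ r-yzx r-zxy))))) ⟩
  sixth * (r x y z + (r x y z + (r x y z + (r x y z + (r x y z + r x y z)))))
    ≡⟨ solve 1 (λ p → con sixth :* (p :+ (p :+ (p :+ (p :+ (p :+ p))))) := p) refl (r x y z) ⟩
  r x y z                                ∎)
  where
  open ≡-Reasoning
  r-zyx : r z y x ≡ r x y z
  r-zyx = sym (trans (s₁₂ x y z) (trans (s₂₃ y x z) (s₁₂ y z x)))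
  r-yzx : r y z x ≡ r x y z
  r-yzx = sym (trans (s₁₂ x y z) (s₂₃ y x z))
  r-zxy : r z x y ≡ r x y z
  r-zxy = sym (trans (s₂₃ x y z) (s₁₂ x z y))

-- The fundamental theorem on symmetric polynomials, for homogeneous
-- polynomial functions, with weighted-homogeneous output.

X₁ₚ X₂ₚ X₃ₚ E₁ E₂ E₃ : Poly3
X₁ₚ = (1ℚ , 1 , 0 , 0) ∷ []
X₂ₚ = (1ℚ , 0 , 1 , 0) ∷ []
X₃ₚ = (1ℚ , 0 , 0 , 1) ∷ []
E₁ = (1ℚ , 1 , 0 , 0) ∷ (1ℚ , 0 , 1 , 0) ∷ (1ℚ , 0 , 0 , 1) ∷ []
E₂ = (1ℚ , 1 , 1 , 0) ∷ (1ℚ , 1 , 0 , 1) ∷ (1ℚ , 0 , 1 , 1) ∷ []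
E₃ = (1ℚ , 1 , 1 , 1) ∷ []

eval-E₁ : ∀ a b c → eval E₁ a b c ≡ e₁ a b c
eval-E₁ = solve 3 (λ a b c → ⟪ E₁ ⟫ a b c := a :+ (b :+ c)) refl

eval-E₂ : ∀ a b c → eval E₂ a b c ≡ e₂ a b c
eval-E₂ = solve 3 (λ a b c → ⟪ E₂ ⟫ a b c := a :* b :+ (a :* c :+ b :* c)) refl

eval-E₃ : ∀ a b c → eval E₃ a b c ≡ e₃ a b c
eval-E₃ = solve 3 (λ a b c → ⟪ E₃ ⟫ a b c := a :* (b :* c)) refl

Elementary₂ : ℕ → Poly3 → Set
Elementary₂ n P = Σ Poly3 λ Q → WHomog 1 2 3 n Q × (∀ a b → eval P a b 0ℚ ≡ eval Q (a + b) (a * b) 0ℚ)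

Elementary₃ : ℕ → Poly3 → Set
Elementary₃ n P = Σ Poly3 λ G → WHomog 1 2 3 n G × (∀ a b c → eval P a b c ≡ eval G (e₁ a b c) (e₂ a b c) (e₃ a b c))

-- With κ = P(1,0,0), T = P − κ(X₁+X₂)ⁿ vanishes on both
-- axes of the plane X₃ = 0, hence T = X₁X₂·S there with S symmetric of
-- degree n − 2; recursively S = Q'(a+b, ab) and P = κX₁ⁿ + X₂·Q' there.
module TwoVariables (P : Poly3) (n : ℕ) (hP : Hom 0 n P) (sym-P : ∀ a b → eval P a b 0ℚ ≡ eval P b a 0ℚ) where

  κ : ℚ
  κ = eval P 1ℚ 0ℚ 0ℚ

  T : Poly3
  T = P -ₚ scaleP κ (powP (X₁ₚ ++ X₂ₚ) n)

  eval-T : ∀ a b c → eval T a b c ≡ eval P a b c - κ * (a + b) ^ n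
  eval-T a b c = trans (eval-−ₚ P (scaleP κ (powP (X₁ₚ ++ X₂ₚ) n)) a b c) (cong (λ p → eval P a b c - p)
    (trans (eval-scaleP κ (powP (X₁ₚ ++ X₂ₚ) n) a b c) (cong (κ *_) (trans (eval-powP (X₁ₚ ++ X₂ₚ) n a b c)
      (cong (_^ n) (solve 2 (λ a b → ⟪ X₁ₚ ++ X₂ₚ ⟫ a b (con c) := a :+ b) refl a b))))))

  hT : Hom 0 n T
  hT = AllP.++⁺ hP (Hom-scaleP (- 1ℚ) _ (Hom-scaleP κ _
         (subst (λ m → Hom 0 m (powP (X₁ₚ ++ X₂ₚ) n)) (ℕP.*-identityʳ n)
           (WHomog-powP {1} {1} {1} (X₁ₚ ++ X₂ₚ) n (refl ∷ refl ∷ [])))))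

  T-axis : ∀ a → eval T a 0ℚ 0ℚ ≡ 0ℚ
  T-axis a = begin
    eval T a 0ℚ 0ℚ                   ≡⟨ eval-T a 0ℚ 0ℚ ⟩
    eval P a 0ℚ 0ℚ - κ * (a + 0ℚ) ^ n ≡⟨ cong₂ (λ p s → p - κ * s ^ n) P-axis (ℚP.+-identityʳ a) ⟩
    a ^ n * κ - κ * a ^ n            ≡⟨ solve 2 (λ p k → p :* k :- k :* p := con 0ℚ) refl (a ^ n) κ ⟩
    0ℚ                               ∎
    where
    open ≡-Reasoning
    P-axis : eval P a 0ℚ 0ℚ ≡ a ^ n * κ
    P-axis = trans (cong₃ (eval P) (sym (ℚP.*-identityʳ a)) (sym (ℚP.*-zeroʳ a)) (sym (ℚP.*-zeroʳ a)))
                   (eval-Hom-scale P hP a 1ℚ 0ℚ 0ℚ)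

  T-sym : ∀ a b → eval T a b 0ℚ ≡ eval T b a 0ℚ
  T-sym a b = trans (eval-T a b 0ℚ) (trans (cong₂ (λ p s → p - κ * s ^ n) (sym-P a b) (ℚP.+-comm a b))
                                          (sym (eval-T b a 0ℚ)))

  T₁ T₂ : Poly3
  T₁ = div₂ T
  T₂ = div₁ T₁

  -- T vanishes on the X₁-axis, so T = X₂·T₁; on the X₂-axis, so T₁ = X₁·T₂
  T-quotient : ∀ a b → eval T a b 0ℚ ≡ b * (a * eval T₂ a b 0ℚ)
  T-quotient a b = trans (T-X₂ a b) (peel b a (eval T₂ a b 0ℚ) (split₁ T₁ a b 0ℚ) (trans (sym (T-X₂ 0ℚ b)) (trans (T-sym 0ℚ b) (T-axis b))))
    where
    T-X₂ : ∀ a b → eval T a b 0ℚ ≡ b * eval T₁ a b 0ℚ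
    T-X₂ a b = factor b (eval T₁ a b 0ℚ) (split₂ T a b 0ℚ) (T-axis a)

  S : Poly3
  S = symmetrise₂ T₂

  decomposition : ∀ a b → eval P a b 0ℚ ≡ κ * (a + b) ^ n + (a * b) * eval S a b 0ℚ
  decomposition a b = begin
    eval P a b 0ℚ                                 ≡⟨ solve 3 (λ p k s → p := k :* s :+ (p :- k :* s)) refl (eval P a b 0ℚ) κ ((a + b) ^ n) ⟩
    κ * (a + b) ^ n + (eval P a b 0ℚ - κ * (a + b) ^ n) ≡⟨ cong (κ * (a + b) ^ n +_) (sym (eval-T a b 0ℚ)) ⟩
    κ * (a + b) ^ n + eval T a b 0ℚ               ≡⟨ cong (κ * (a + b) ^ n +_) (symmetrise₂-quotient (λ a b → eval T a b 0ℚ) T₂ T-sym T-quotient a b) ⟩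
    κ * (a + b) ^ n + (a * b) * eval S a b 0ℚ     ∎
    where open ≡-Reasoning

  S-sym : ∀ a b → eval S a b 0ℚ ≡ eval S b a 0ℚ
  S-sym a b = trans (eval-symmetrise₂ T₂ a b 0ℚ) (trans (cong (½ *_) (ℚP.+-comm (eval T₂ a b 0ℚ) (eval T₂ b a 0ℚ)))
                                                        (sym (eval-symmetrise₂ T₂ b a 0ℚ)))

  hT₂ : Hom 2 n T₂
  hT₂ = Hom-div₁ {1} T₁ (Hom-div₂ {0} T hT)

  hS : ∀ m → n ≡ 2 ℕ.+ m → Hom 0 m S
  hS m refl = Hom-symmetrise₂ T₂ (Hom-shift {2} T₂ hT₂)

  S-vanishes : n ℕ.< 2 → ∀ a b → eval S a b 0ℚ ≡ eval [] (a + b) (a * b) 0ℚ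
  S-vanishes lt a b rewrite Hom-empty {2} T₂ hT₂ lt = ℚP.*-zeroʳ ½

  assemble : ∀ Q' → WHomog 1 2 3 n (mulP X₂ₚ Q') → (∀ a b → eval S a b 0ℚ ≡ eval Q' (a + b) (a * b) 0ℚ) → Elementary₂ n P
  assemble Q' hQ' S≡Q' = (κ , n , 0 , 0) ∷ mulP X₂ₚ Q' , degree-κ ∷ hQ' , λ a b → begin
    eval P a b 0ℚ                                       ≡⟨ decomposition a b ⟩
    κ * (a + b) ^ n + (a * b) * eval S a b 0ℚ           ≡⟨ cong (λ s → κ * (a + b) ^ n + (a * b) * s) (S≡Q' a b) ⟩
    κ * (a + b) ^ n + (a * b) * eval Q' (a + b) (a * b) 0ℚ
      ≡⟨ cong₂ _+_ (solve 2 (λ k p → k :* p := k :* (p :* (con 1ℚ :* con 1ℚ))) refl κ ((a + b) ^ n))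
                   (sym (trans (eval-mulP X₂ₚ Q' (a + b) (a * b) 0ℚ)
                        (cong (_* eval Q' (a + b) (a * b) 0ℚ) (solve 2 (λ s p → ⟪ X₂ₚ ⟫ s p (con 0ℚ) := p) refl (a + b) (a * b))))) ⟩
    eval ((κ , n , 0 , 0) ∷ mulP X₂ₚ Q') (a + b) (a * b) 0ℚ ∎
    where
    open ≡-Reasoning
    degree-κ : 1 ℕ.* n ℕ.+ 2 ℕ.* 0 ℕ.+ 3 ℕ.* 0 ≡ n
    degree-κ = trans (ℕP.+-identityʳ _) (trans (ℕP.+-identityʳ _) (ℕP.*-identityˡ n))

elementary₂ : ∀ n P → Hom 0 n P → (∀ a b → eval P a b 0ℚ ≡ eval P b a 0ℚ) → Elementary₂ n P
elementary₂ zero          P hP sym-P = assemble [] [] (S-vanishes (s≤s z≤n))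
  where open TwoVariables P 0 hP sym-P
elementary₂ (suc zero)    P hP sym-P = assemble [] [] (S-vanishes (s≤s (s≤s z≤n)))
  where open TwoVariables P 1 hP sym-P
elementary₂ (suc (suc m)) P hP sym-P =
  let (Q' , hQ' , S≡Q') = elementary₂ m S (hS m refl) S-sym
  in assemble Q' (WHomog-mulP {1} {2} {3} X₂ₚ Q' (refl ∷ []) hQ') S≡Q'
  where open TwoVariables P (suc (suc m)) hP sym-P

-- With Q from the two-variable case, R = P − Q(e₁,e₂,e₃)
-- vanishes on X₃ = 0, hence by symmetry on all coordinate planes, so
-- R = X₁X₂X₃·U with U symmetric of degree n − 3; recursively U = G'(e) and
-- P = (Q + X₃·G')(e).
module ThreeVariables (P : Poly3) (n : ℕ) (hP : Hom 0 n P)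
  (s₁₂ : ∀ a b c → eval P a b c ≡ eval P b a c) (s₂₃ : ∀ a b c → eval P a b c ≡ eval P a c b) where

  Q : Poly3
  Q = proj₁ (elementary₂ n P hP (λ a b → s₁₂ a b 0ℚ))

  hQ : WHomog 1 2 3 n Q
  hQ = proj₁ (proj₂ (elementary₂ n P hP (λ a b → s₁₂ a b 0ℚ)))

  P≡Q : ∀ a b → eval P a b 0ℚ ≡ eval Q (a + b) (a * b) 0ℚ
  P≡Q = proj₂ (proj₂ (elementary₂ n P hP (λ a b → s₁₂ a b 0ℚ)))

  qₑ : ℚ → ℚ → ℚ → ℚ
  qₑ a b c = eval Q (e₁ a b c) (e₂ a b c) (e₃ a b c)

  R : Poly3
  R = P -ₚ substP Q E₁ E₂ E₃

  eval-R : ∀ a b c → eval R a b c ≡ eval P a b c - qₑ a b c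
  eval-R a b c = trans (eval-−ₚ P (substP Q E₁ E₂ E₃) a b c) (cong (_-_ (eval P a b c))
    (trans (eval-substP Q E₁ E₂ E₃ a b c) (cong₃ (eval Q) (eval-E₁ a b c) (eval-E₂ a b c) (eval-E₃ a b c))))

  hR : Hom 0 n R
  hR = AllP.++⁺ hP (Hom-scaleP (- 1ℚ) _ (WHomog-substP {1} {1} {1} Q E₁ E₂ E₃ hQ (refl ∷ refl ∷ refl ∷ []) (refl ∷ refl ∷ refl ∷ []) (refl ∷ [])))

  r : ℚ → ℚ → ℚ → ℚ
  r = eval R

  r-plane : ∀ a b → r a b 0ℚ ≡ 0ℚ
  r-plane a b = trans (eval-R a b 0ℚ) (trans (cong₂ _-_ (P≡Q a b)
     (cong₃ (eval Q) (solve 2 (λ a b → a :+ (b :+ con 0ℚ) := a :+ b) refl a b)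
                     (solve 2 (λ a b → a :* b :+ (a :* con 0ℚ :+ b :* con 0ℚ) := a :* b) refl a b)
                     (solve 2 (λ a b → a :* (b :* con 0ℚ) := con 0ℚ) refl a b)))
     (ℚP.+-inverseʳ (eval Q (a + b) (a * b) 0ℚ)))

  -- the values of e₁, e₂, e₃ are symmetric, so R inherits the symmetry of P
  r-swap₁₂ : ∀ a b c → r a b c ≡ r b a c
  r-swap₁₂ a b c = trans (eval-R a b c) (trans (cong₂ _-_ (s₁₂ a b c)
     (cong₃ (eval Q) (solve 3 (λ a b c → a :+ (b :+ c) := b :+ (a :+ c)) refl a b c)
                     (solve 3 (λ a b c → a :* b :+ (a :* c :+ b :* c) := b :* a :+ (b :* c :+ a :* c)) refl a b c)
                     (solve 3 (λ a b c → a :* (b :* c) := b :* (a :* c)) refl a b c)))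
     (sym (eval-R b a c)))

  r-swap₂₃ : ∀ a b c → r a b c ≡ r a c b
  r-swap₂₃ a b c = trans (eval-R a b c) (trans (cong₂ _-_ (s₂₃ a b c)
     (cong₃ (eval Q) (solve 3 (λ a b c → a :+ (b :+ c) := a :+ (c :+ b)) refl a b c)
                     (solve 3 (λ a b c → a :* b :+ (a :* c :+ b :* c) := a :* c :+ (a :* b :+ c :* b)) refl a b c)
                     (solve 3 (λ a b c → a :* (b :* c) := a :* (c :* b)) refl a b c)))
     (sym (eval-R a c b)))

  R₁ R₂ R₃ : Poly3
  R₁ = div₃ R
  R₂ = div₂ R₁
  R₃ = div₁ R₂

  -- divide successively by X₃, X₂, X₁, each time using that r vanishes on
  -- the corresponding coordinate plane
  r-quotient : ∀ a b c → r a b c ≡ c * (b * (a * eval R₃ a b c))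
  r-quotient a b c = begin
    r a b c                              ≡⟨ r-X₃ a b c ⟩
    c * eval R₁ a b c                    ≡⟨ r-X₂X₃ a b c ⟩
    c * (b * eval R₂ a b c)              ≡⟨ sym (ℚP.*-assoc c b _) ⟩
    (c * b) * eval R₂ a b c              ≡⟨ peel (c * b) a (eval R₃ a b c) (split₁ R₂ a b c)
                                              (trans (ℚP.*-assoc c b _) (trans (sym (r-X₂X₃ 0ℚ b c))
                                                (trans (sym (r-X₃ 0ℚ b c)) (trans (r-swap₁₂ 0ℚ b c) (trans (r-swap₂₃ b 0ℚ c) (r-plane b c)))))) ⟩
    (c * b) * (a * eval R₃ a b c)        ≡⟨ ℚP.*-assoc c b _ ⟩
    c * (b * (a * eval R₃ a b c))        ∎
    where
    open ≡-Reasoning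
    r-X₃ : ∀ a b c → r a b c ≡ c * eval R₁ a b c
    r-X₃ a b c = factor c (eval R₁ a b c) (split₃ R a b c) (r-plane a b)
    r-X₂X₃ : ∀ a b c → c * eval R₁ a b c ≡ c * (b * eval R₂ a b c)
    r-X₂X₃ a b c = peel c b (eval R₂ a b c) (split₂ R₁ a b c) (trans (sym (r-X₃ a 0ℚ c)) (trans (r-swap₂₃ a 0ℚ c) (r-plane a c)))

  U : Poly3
  U = symmetrise₃ R₃

  decomposition : ∀ a b c → eval P a b c ≡ qₑ a b c + e₃ a b c * eval U a b c
  decomposition a b c = begin
    eval P a b c                    ≡⟨ solve 2 (λ p q → p := q :+ (p :- q)) refl (eval P a b c) (qₑ a b c) ⟩
    qₑ a b c + (eval P a b c - qₑ a b c) ≡⟨ cong (qₑ a b c +_) (sym (eval-R a b c)) ⟩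
    qₑ a b c + r a b c               ≡⟨ cong (qₑ a b c +_) (symmetrise₃-quotient r R₃ r-swap₁₂ r-swap₂₃ r-quotient a b c) ⟩
    qₑ a b c + e₃ a b c * eval U a b c ∎
    where open ≡-Reasoning

  hR₃ : Hom 3 n R₃
  hR₃ = Hom-div₁ {2} R₂ (Hom-div₂ {1} R₁ (Hom-div₃ {0} R hR))

  hU : ∀ m → n ≡ 3 ℕ.+ m → Hom 0 m U
  hU m refl = Hom-symmetrise₃ R₃ (Hom-shift {3} R₃ hR₃)

  U-vanishes : n ℕ.< 3 → ∀ a b c → eval U a b c ≡ eval [] (e₁ a b c) (e₂ a b c) (e₃ a b c)
  U-vanishes lt a b c rewrite Hom-empty {3} R₃ hR₃ lt = ℚP.*-zeroʳ sixth

  assemble : ∀ G' → WHomog 1 2 3 n (mulP X₃ₚ G') →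
    (∀ a b c → eval U a b c ≡ eval G' (e₁ a b c) (e₂ a b c) (e₃ a b c)) → Elementary₃ n P
  assemble G' hG' U≡G' = Q ++ mulP X₃ₚ G' , AllP.++⁺ hQ hG' , λ a b c → begin
    eval P a b c                                      ≡⟨ decomposition a b c ⟩
    qₑ a b c + e₃ a b c * eval U a b c                 ≡⟨ cong (λ u → qₑ a b c + e₃ a b c * u) (U≡G' a b c) ⟩
    qₑ a b c + e₃ a b c * eval G' (e₁ a b c) (e₂ a b c) (e₃ a b c)
      ≡⟨ cong (qₑ a b c +_) (sym (trans (eval-mulP X₃ₚ G' _ _ _)
           (cong (_* eval G' (e₁ a b c) (e₂ a b c) (e₃ a b c))
             (solve 3 (λ s p t → ⟪ X₃ₚ ⟫ s p t := t) refl (e₁ a b c) (e₂ a b c) (e₃ a b c))))) ⟩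
    qₑ a b c + eval (mulP X₃ₚ G') (e₁ a b c) (e₂ a b c) (e₃ a b c)
      ≡⟨ sym (eval-++ Q (mulP X₃ₚ G') _ _ _) ⟩
    eval (Q ++ mulP X₃ₚ G') (e₁ a b c) (e₂ a b c) (e₃ a b c) ∎
    where open ≡-Reasoning

elementary₃ : ∀ n P → Hom 0 n P →
  (∀ a b c → eval P a b c ≡ eval P b a c) → (∀ a b c → eval P a b c ≡ eval P a c b) → Elementary₃ n P
elementary₃ zero                P hP s₁₂ s₂₃ = assemble [] [] (U-vanishes (s≤s z≤n))
  where open ThreeVariables P 0 hP s₁₂ s₂₃
elementary₃ (suc zero)          P hP s₁₂ s₂₃ = assemble [] [] (U-vanishes (s≤s (s≤s z≤n)))
  where open ThreeVariables P 1 hP s₁₂ s₂₃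
elementary₃ (suc (suc zero))    P hP s₁₂ s₂₃ = assemble [] [] (U-vanishes (s≤s (s≤s (s≤s z≤n))))
  where open ThreeVariables P 2 hP s₁₂ s₂₃
elementary₃ (suc (suc (suc m))) P hP s₁₂ s₂₃ =
  let (G' , hG' , U≡G') = elementary₃ m U (hU m refl) (symmetrise₃-swap₁₂ R₃) (symmetrise₃-swap₂₃ R₃)
  in assemble G' (WHomog-mulP {1} {2} {3} X₃ₚ G' (refl ∷ []) hG') U≡G'
  where open ThreeVariables P (suc (suc (suc m))) hP s₁₂ s₂₃

-- Finite sums over L and over Lⁿ

ΣL : (L → ℚ) → ℚ
ΣL g = g o + (g e + (g ω + g ω̄))

ΣV : (n : ℕ) → (Vec L n → ℚ) → ℚ
ΣV zero    f = f []
ΣV (suc n) f = ΣL (λ a → ΣV n (λ w → f (a ∷ w)))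

ΣL-cong : ∀ {f g : L → ℚ} → (∀ a → f a ≡ g a) → ΣL f ≡ ΣL g
ΣL-cong h = cong₂ _+_ (h o) (cong₂ _+_ (h e) (cong₂ _+_ (h ω) (h ω̄)))

ΣV-cong : ∀ n {f g : Vec L n → ℚ} → (∀ v → f v ≡ g v) → ΣV n f ≡ ΣV n g
ΣV-cong zero    h = h []
ΣV-cong (suc n) h = ΣL-cong (λ a → ΣV-cong n (λ w → h (a ∷ w)))

ΣV-+ : ∀ n (f g : Vec L n → ℚ) → ΣV n (λ v → f v + g v) ≡ ΣV n f + ΣV n g
ΣV-+ zero    f g = refl
ΣV-+ (suc n) f g = trans (ΣL-cong (λ a → ΣV-+ n (λ w → f (a ∷ w)) (λ w → g (a ∷ w))))
  (solve 8 (λ a b c d a' b' c' d' → (a :+ a') :+ ((b :+ b') :+ ((c :+ c') :+ (d :+ d')))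
        := (a :+ (b :+ (c :+ d))) :+ (a' :+ (b' :+ (c' :+ d')))) refl
     (F o) (F e) (F ω) (F ω̄) (G o) (G e) (G ω) (G ω̄))
  where
  F G : L → ℚ
  F a = ΣV n (λ w → f (a ∷ w))
  G a = ΣV n (λ w → g (a ∷ w))

ΣV-* : ∀ n k (f : Vec L n → ℚ) → ΣV n (λ v → k * f v) ≡ k * ΣV n f
ΣV-* zero    k f = refl
ΣV-* (suc n) k f = trans (ΣL-cong (λ a → ΣV-* n k (λ w → f (a ∷ w))))
  (solve 5 (λ k a b c d → k :* a :+ (k :* b :+ (k :* c :+ k :* d)) := k :* (a :+ (b :+ (c :+ d)))) refl
     k (F o) (F e) (F ω) (F ω̄))
  where
  F : L → ℚ
  F a = ΣV n (λ w → f (a ∷ w))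

ΣV-0 : ∀ n (f : Vec L n → ℚ) → (∀ v → f v ≡ 0ℚ) → ΣV n f ≡ 0ℚ
ΣV-0 zero    f h = h []
ΣV-0 (suc n) f h = ΣL-cong (λ a → ΣV-0 n (λ w → f (a ∷ w)) (λ w → h (a ∷ w)))

ΣV-swap : ∀ n m (h : Vec L n → Vec L m → ℚ) → ΣV n (λ v → ΣV m (λ w → h v w)) ≡ ΣV m (λ w → ΣV n (λ v → h v w))
ΣV-swap zero    m h = refl
ΣV-swap (suc n) m h = trans (ΣL-cong (λ a → ΣV-swap n m (λ v w → h (a ∷ v) w)))
  (sym (trans (ΣV-+ m (G o) _) (cong (ΣV m (G o) +_) (trans (ΣV-+ m (G e) _) (cong (ΣV m (G e) +_) (ΣV-+ m (G ω) (G ω̄)))))))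
  where
  G : L → Vec L m → ℚ
  G a w = ΣV n (λ v → h (a ∷ v) w)

ΣL-translate : ∀ (g : L → ℚ) d → ΣL (λ a → g (a ⊕ d)) ≡ ΣL g
ΣL-translate g o = refl
ΣL-translate g e = solve 4 (λ a b c d → b :+ (a :+ (d :+ c)) := a :+ (b :+ (c :+ d))) refl (g o) (g e) (g ω) (g ω̄)
ΣL-translate g ω = solve 4 (λ a b c d → c :+ (d :+ (a :+ b)) := a :+ (b :+ (c :+ d))) refl (g o) (g e) (g ω) (g ω̄)
ΣL-translate g ω̄ = solve 4 (λ a b c d → d :+ (c :+ (b :+ a)) := a :+ (b :+ (c :+ d))) refl (g o) (g e) (g ω) (g ω̄)

ΣV-translate : ∀ n (f : Vec L n → ℚ) d → ΣV n (λ v → f (v ⊕ᵛ d)) ≡ ΣV n f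
ΣV-translate zero    f []       = refl
ΣV-translate (suc n) f (d ∷ ds) = trans (ΣL-cong (λ a → ΣV-translate n (λ w → f ((a ⊕ d) ∷ w)) ds))
  (ΣL-translate (λ b → ΣV n (λ w → f (b ∷ w))) d)

ΣV-nonneg : ∀ n (f : Vec L n → ℚ) → (∀ v → 0ℚ ℚ.≤ f v) → 0ℚ ℚ.≤ ΣV n f
ΣV-nonneg zero    f h = h []
ΣV-nonneg (suc n) f h =
  +-nonneg (F≥0 o) (+-nonneg (F≥0 e) (+-nonneg (F≥0 ω) (F≥0 ω̄)))
  where
  +-nonneg : ∀ {p q} → 0ℚ ℚ.≤ p → 0ℚ ℚ.≤ q → 0ℚ ℚ.≤ p + q
  +-nonneg p≥0 q≥0 = ℚP.+-mono-≤ p≥0 q≥0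
  F≥0 : ∀ a → 0ℚ ℚ.≤ ΣV n (λ w → f (a ∷ w))
  F≥0 a = ΣV-nonneg n _ (λ w → h (a ∷ w))

𝟙 : Bool → ℚ
𝟙 true  = 1ℚ
𝟙 false = 0ℚ

sumMap : ∀ {A : Set} → (A → ℚ) → List A → ℚ
sumMap g xs = sumℚ (map g xs)

sumMap-++ : ∀ {A : Set} (g : A → ℚ) xs ys → sumMap g (xs ++ ys) ≡ sumMap g xs + sumMap g ys
sumMap-++ g []       ys = sym (ℚP.+-identityˡ _)
sumMap-++ g (x ∷ xs) ys = trans (cong (g x +_) (sumMap-++ g xs ys)) (sym (ℚP.+-assoc (g x) (sumMap g xs) (sumMap g ys)))

sumMap-map : ∀ {A B : Set} (g : B → ℚ) (h : A → B) xs → sumMap g (map h xs) ≡ sumMap (λ x → g (h x)) xs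
sumMap-map g h []       = refl
sumMap-map g h (x ∷ xs) = cong (g (h x) +_) (sumMap-map g h xs)

sumMap-filter : ∀ {n} (C : Code n) (g : Vec L n → ℚ) xs →
  sumMap g (filter (λ c → T? (C c)) xs) ≡ sumMap (λ v → 𝟙 (C v) * g v) xs
sumMap-filter C g []       = refl
sumMap-filter C g (x ∷ xs) with C x
... | true  = cong₂ _+_ (sym (ℚP.*-identityˡ (g x))) (sumMap-filter C g xs)
... | false = trans (sumMap-filter C g xs)
                (sym (trans (cong (_+ sumMap (λ v → 𝟙 (C v) * g v) xs) (ℚP.*-zeroˡ (g x))) (ℚP.+-identityˡ _)))

sumMap-allVecs : ∀ n (g : Vec L n → ℚ) → sumMap g (allVecs n) ≡ ΣV n g
sumMap-allVecs zero    g = ℚP.+-identityʳ (g [])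
sumMap-allVecs (suc n) g =
  trans (sumMap-++ g (map (o ∷_) (allVecs n)) _) (cong₂ _+_ (part o)
  (trans (sumMap-++ g (map (e ∷_) (allVecs n)) _) (cong₂ _+_ (part e)
  (trans (sumMap-++ g (map (ω ∷_) (allVecs n)) _) (cong₂ _+_ (part ω)
  (trans (sumMap-++ g (map (ω̄ ∷_) (allVecs n)) []) (trans (ℚP.+-identityʳ _) (part ω̄))))))))
  where
  part : ∀ a → sumMap g (map (a ∷_) (allVecs n)) ≡ ΣV n (λ w → g (a ∷ w))
  part a = trans (sumMap-map g (a ∷_) (allVecs n)) (sumMap-allVecs n (λ w → g (a ∷ w)))

prodT : ∀ {n} → (L → ℚ) → Vec L n → ℚ
prodT t []      = 1ℚ
prodT t (a ∷ v) = t a * prodT t v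

prodT-cong : ∀ {n} {t t' : L → ℚ} → (∀ a → t a ≡ t' a) → (v : Vec L n) → prodT t v ≡ prodT t' v
prodT-cong h []      = refl
prodT-cong h (a ∷ v) = cong₂ _*_ (h a) (prodT-cong h v)

weight : ℚ → ℚ → ℚ → L → ℚ
weight x y z o  = x
weight x y z e  = y
weight x y z ω  = z
weight x y z ω̄  = z

monomial : ∀ {n} → ℚ → ℚ → ℚ → Vec L n → ℚ
monomial x y z c = (x ^ n₀ c) * ((y ^ n₁ c) * (z ^ n₂ c))

monomial-prodT : ∀ {n} x y z (v : Vec L n) → monomial x y z v ≡ prodT (weight x y z) v
monomial-prodT x y z []       = solve 0 (con 1ℚ :* (con 1ℚ :* con 1ℚ) := con 1ℚ) refl
monomial-prodT x y z (o ∷ v)  = trans (solve 4 (λ x a b c → (x :* a) :* (b :* c) := x :* (a :* (b :* c))) refl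
                                  x (x ^ n₀ v) (y ^ n₁ v) (z ^ n₂ v)) (cong (x *_) (monomial-prodT x y z v))
monomial-prodT x y z (e ∷ v)  = trans (solve 4 (λ y a b c → a :* ((y :* b) :* c) := y :* (a :* (b :* c))) refl
                                  y (x ^ n₀ v) (y ^ n₁ v) (z ^ n₂ v)) (cong (y *_) (monomial-prodT x y z v))
monomial-prodT x y z (ω ∷ v)  = trans (solve 4 (λ z a b c → a :* (b :* (z :* c)) := z :* (a :* (b :* c))) refl
                                  z (x ^ n₀ v) (y ^ n₁ v) (z ^ n₂ v)) (cong (z *_) (monomial-prodT x y z v))
monomial-prodT x y z (ω̄ ∷ v) = trans (solve 4 (λ z a b c → a :* (b :* (z :* c)) := z :* (a :* (b :* c))) refl
                                  z (x ^ n₀ v) (y ^ n₁ v) (z ^ n₂ v)) (cong (z *_) (monomial-prodT x y z v))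

W : ∀ {n} → Code n → ℚ → ℚ → ℚ → ℚ
W {n} C x y z = ΣV n (λ v → 𝟙 (C v) * prodT (weight x y z) v)

swe≡W : ∀ {n} (C : Code n) x y z → swe C x y z ≡ W C x y z
swe≡W {n} C x y z = trans (sumMap-filter C (monomial x y z) (allVecs n))
  (trans (sumMap-allVecs n (λ v → 𝟙 (C v) * monomial x y z v))
         (ΣV-cong n (λ v → cong (𝟙 (C v) *_) (monomial-prodT x y z v))))

-- The form on L.  Its bilinearity and symmetry, and the cancellation law
-- of L, are finite checks, decided by evaluation.

∀L? : {P : L → Set} → (∀ x → Dec (P x)) → Dec (∀ x → P x)
∀L? P? with P? o | P? e | P? ω | P? ω̄
... | yes p₀ | yes p₁ | yes p₂ | yes p₃ = yes λ { o → p₀ ; e → p₁ ; ω → p₂ ; ω̄ → p₃ }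
... | no ¬p  | _      | _      | _      = no (λ h → ¬p (h o))
... | yes _  | no ¬p  | _      | _      = no (λ h → ¬p (h e))
... | yes _  | yes _  | no ¬p  | _      = no (λ h → ¬p (h ω))
... | yes _  | yes _  | yes _  | no ¬p  = no (λ h → ¬p (h ω̄))

_≟ᴸ_ : (x y : L) → Dec (x ≡ y)
x ≟ᴸ y = map′ (λ eq → trans (sym (decode-code x)) (trans (cong decode eq) (decode-code y))) (cong code) (code x ℕ.≟ code y)
  where
  code : L → ℕ
  code o = 0
  code e = 1
  code ω = 2
  code ω̄ = 3
  decode : ℕ → L
  decode 0 = o
  decode 1 = e
  decode 2 = ω
  decode _ = ω̄
  decode-code : ∀ x → decode (code x) ≡ x
  decode-code o = refl
  decode-code e = refl
  decode-code ω = refl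
  decode-code ω̄ = refl

·-bilinear : ∀ x y z → (x ⊕ y) · z ≡ (x · z) xor (y · z)
·-bilinear = toWitness {a? = ∀L? λ x → ∀L? λ y → ∀L? λ z → ((x ⊕ y) · z) Bool.≟ ((x · z) xor (y · z))} _

·-sym : ∀ x y → x · y ≡ y · x
·-sym = toWitness {a? = ∀L? λ x → ∀L? λ y → (x · y) Bool.≟ (y · x)} _

⊕-cancel : ∀ x y → (x ⊕ y) ⊕ y ≡ x
⊕-cancel = toWitness {a? = ∀L? λ x → ∀L? λ y → ((x ⊕ y) ⊕ y) ≟ᴸ x} _

⟨⟩-bilinear : ∀ {n} (x y z : Vec L n) → ⟨ x ⊕ᵛ y , z ⟩ ≡ ⟨ x , z ⟩ xor ⟨ y , z ⟩
⟨⟩-bilinear []       []       []       = refl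
⟨⟩-bilinear (x ∷ xs) (y ∷ ys) (z ∷ zs) =
  trans (cong₂ _xor_ (·-bilinear x y z) (⟨⟩-bilinear xs ys zs)) (xor-interchange (x · z) (y · z) ⟨ xs , zs ⟩ ⟨ ys , zs ⟩)

⟨⟩-sym : ∀ {n} (x y : Vec L n) → ⟨ x , y ⟩ ≡ ⟨ y , x ⟩
⟨⟩-sym []       []       = refl
⟨⟩-sym (x ∷ xs) (y ∷ ys) = cong₂ _xor_ (·-sym x y) (⟨⟩-sym xs ys)

⊕ᵛ-cancel : ∀ {n} (x y : Vec L n) → (x ⊕ᵛ y) ⊕ᵛ y ≡ x
⊕ᵛ-cancel []       []       = refl
⊕ᵛ-cancel (x ∷ xs) (y ∷ ys) = cong₂ _∷_ (⊕-cancel x y) (⊕ᵛ-cancel xs ys)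

-- Characters and the Fourier transform of product functions

χ : Bool → ℚ
χ false = 1ℚ
χ true  = - 1ℚ

χ-xor : ∀ p q → χ (p xor q) ≡ χ p * χ q
χ-xor false false = refl
χ-xor false true  = refl
χ-xor true  false = refl
χ-xor true  true  = refl

transform : (L → ℚ) → L → ℚ
transform t u = ΣL (λ w → χ (u · w) * t w)

fourier : ∀ n (t : L → ℚ) (c : Vec L n) → prodT (transform t) c ≡ ΣV n (λ v → χ ⟨ c , v ⟩ * prodT t v)
fourier zero    t []      = refl
fourier (suc n) t (a ∷ c) = sym (begin
  ΣL (λ w → ΣV n (λ v → χ ((a · w) xor ⟨ c , v ⟩) * (t w * prodT t v)))
    ≡⟨ ΣL-cong (λ w → ΣV-cong n (λ v → trans (cong (_* (t w * prodT t v)) (χ-xor (a · w) ⟨ c , v ⟩))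
         (solve 4 (λ p q r s → (p :* q) :* (r :* s) := (p :* r) :* (q :* s)) refl (χ (a · w)) (χ ⟨ c , v ⟩) (t w) (prodT t v)))) ⟩
  ΣL (λ w → ΣV n (λ v → (χ (a · w) * t w) * (χ ⟨ c , v ⟩ * prodT t v)))
    ≡⟨ ΣL-cong (λ w → ΣV-* n (χ (a · w) * t w) (λ v → χ ⟨ c , v ⟩ * prodT t v)) ⟩
  ΣL (λ w → (χ (a · w) * t w) * S)
    ≡⟨ solve 5 (λ p q r s k → p :* k :+ (q :* k :+ (r :* k :+ s :* k)) := (p :+ (q :+ (r :+ s))) :* k) refl
         (χ (a · o) * t o) (χ (a · e) * t e) (χ (a · ω) * t ω) (χ (a · ω̄) * t ω̄) S ⟩
  transform t a * S
    ≡⟨ cong (transform t a *_) (sym (fourier n t c)) ⟩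
  transform t a * prodT (transform t) c ∎)
  where
  open ≡-Reasoning
  S = ΣV n (λ v → χ ⟨ c , v ⟩ * prodT t v)

search : ∀ n (p : Vec L n → Bool) → (Σ (Vec L n) λ v → p v ≡ true) ⊎ (∀ v → p v ≡ false)
search zero p with p [] in eq
... | true  = inj₁ ([] , eq)
... | false = inj₂ (λ { [] → eq })
search (suc n) p with search n (λ w → p (o ∷ w)) | search n (λ w → p (e ∷ w))
                    | search n (λ w → p (ω ∷ w)) | search n (λ w → p (ω̄ ∷ w))
... | inj₁ (w , h) | _            | _            | _            = inj₁ (o ∷ w , h)
... | inj₂ _       | inj₁ (w , h) | _            | _            = inj₁ (e ∷ w , h)
... | inj₂ _       | inj₂ _       | inj₁ (w , h) | _            = inj₁ (ω ∷ w , h)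
... | inj₂ _       | inj₂ _       | inj₂ _       | inj₁ (w , h) = inj₁ (ω̄ ∷ w , h)
... | inj₂ h₀      | inj₂ h₁      | inj₂ h₂      | inj₂ h₃      =
  inj₂ λ { (o ∷ w) → h₀ w ; (e ∷ w) → h₁ w ; (ω ∷ w) → h₂ w ; (ω̄ ∷ w) → h₃ w }

-- In a self-dual code, a character sum either sees only +1's or cancels.
module SelfDual {n : ℕ} (C : Code n) (sd : IsSelfDual C) where
  open IsSelfDual sd

  size : ℚ
  size = ΣV n (λ c → 𝟙 (C c))

  -- a codeword c₀ with ⟨c₀,v⟩ = 1 makes the character sum at v vanish:
  -- translating by c₀ permutes C and flips every sign
  orthogonal-vanishes : ∀ v c₀ → C c₀ ≡ true → ⟨ c₀ , v ⟩ ≡ true → ΣV n (λ c → 𝟙 (C c) * χ ⟨ c , v ⟩) ≡ 0ℚ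
  orthogonal-vanishes v c₀ c₀∈C ⟨c₀,v⟩≡1 = begin
    S                                    ≡⟨ solve 1 (λ s → s := con ½ :* (s :+ s)) refl S ⟩
    ½ * (S + S)                          ≡⟨ cong (λ s → ½ * (S + s)) S≡-S ⟩
    ½ * (S + (- 1ℚ) * S)                 ≡⟨ solve 1 (λ s → con ½ :* (s :+ con (- 1ℚ) :* s) := con 0ℚ) refl S ⟩
    0ℚ                                   ∎
    where
    open ≡-Reasoning
    S : ℚ
    S = ΣV n (λ c → 𝟙 (C c) * χ ⟨ c , v ⟩)
    coset : ∀ c → C (c ⊕ᵛ c₀) ≡ C c
    coset c with C c in c∈C
    ... | true = proj₂ subgroup c c₀ c∈C c₀∈C
    ... | false with C (c ⊕ᵛ c₀) in c+c₀∈C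
    ...   | false = refl
    ...   | true with trans (sym c∈C) (trans (cong C (sym (⊕ᵛ-cancel c c₀))) (proj₂ subgroup (c ⊕ᵛ c₀) c₀ c+c₀∈C c₀∈C))
    ...     | ()
    flip : ∀ c → 𝟙 (C (c ⊕ᵛ c₀)) * χ ⟨ c ⊕ᵛ c₀ , v ⟩ ≡ (- 1ℚ) * (𝟙 (C c) * χ ⟨ c , v ⟩)
    flip c rewrite coset c | ⟨⟩-bilinear c c₀ v | ⟨c₀,v⟩≡1 | χ-xor ⟨ c , v ⟩ true =
      solve 2 (λ a b → a :* (b :* con (- 1ℚ)) := con (- 1ℚ) :* (a :* b)) refl (𝟙 (C c)) (χ ⟨ c , v ⟩)
    S≡-S : S ≡ (- 1ℚ) * S
    S≡-S = trans (sym (ΣV-translate n (λ c → 𝟙 (C c) * χ ⟨ c , v ⟩) c₀))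
             (trans (ΣV-cong n flip) (ΣV-* n (- 1ℚ) (λ c → 𝟙 (C c) * χ ⟨ c , v ⟩)))

  character-sum : ∀ v → ΣV n (λ c → 𝟙 (C c) * χ ⟨ c , v ⟩) ≡ 𝟙 (C v) * size
  character-sum v with C v in v∈C
  ... | true = trans (ΣV-cong n trivial) (sym (ℚP.*-identityˡ size))
    where
    -- v ∈ C = C^⊥: every sign is +1
    trivial : ∀ c → 𝟙 (C c) * χ ⟨ c , v ⟩ ≡ 𝟙 (C c)
    trivial c with C c in c∈C
    ... | true rewrite inDual c v c∈C v∈C = refl
    ... | false = ℚP.*-zeroˡ (χ ⟨ c , v ⟩)
  ... | false with search n (λ y → C y ∧ ⟨ v , y ⟩)
  ...   | inj₁ (c₀ , h) = trans (orthogonal-vanishes v c₀ (proj₁ (∧-true h)) (trans (⟨⟩-sym c₀ v) (proj₂ (∧-true h))))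
                                (sym (ℚP.*-zeroˡ size))
    where
    ∧-true : ∀ {a b} → a ∧ b ≡ true → (a ≡ true) × (b ≡ true)
    ∧-true {true} {true} refl = refl , refl
  -- v ∉ C = C^⊥, so some codeword is not orthogonal to v
  ...   | inj₂ none = ⊥-elim (false≢true (trans (sym v∈C) (dualIn v (λ y y∈C → subst (λ b → b ∧ ⟨ v , y ⟩ ≡ false) y∈C (none y)))))
    where
    false≢true : false ≡ true → ⊥
    false≢true ()

-- The MacWilliams identity for self-dual codes:
--   W(x+y+2z, x+y−2z, x−y) = |C| · W(x, y, z),
-- because t̂ for t = weight x y z is weight (x+y+2z) (x+y−2z) (x−y).

T₁ T₂ T₃ : ℚ → ℚ → ℚ → ℚ
T₁ x y z = x + (y + (z + z))
T₂ x y z = x + (y + - (z + z))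
T₃ x y z = x + - y

transform-weight : ∀ x y z u → weight (T₁ x y z) (T₂ x y z) (T₃ x y z) u ≡ transform (weight x y z) u
transform-weight x y z o  = solve 3 (λ x y z → x :+ (y :+ (z :+ z))
  := con 1ℚ :* x :+ (con 1ℚ :* y :+ (con 1ℚ :* z :+ con 1ℚ :* z))) refl x y z
transform-weight x y z e  = solve 3 (λ x y z → x :+ (y :+ :- (z :+ z))
  := con 1ℚ :* x :+ (con 1ℚ :* y :+ (con (- 1ℚ) :* z :+ con (- 1ℚ) :* z))) refl x y z
transform-weight x y z ω  = solve 3 (λ x y z → x :+ :- y
  := con 1ℚ :* x :+ (con (- 1ℚ) :* y :+ (con 1ℚ :* z :+ con (- 1ℚ) :* z))) refl x y z
transform-weight x y z ω̄ = solve 3 (λ x y z → x :+ :- y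
  := con 1ℚ :* x :+ (con (- 1ℚ) :* y :+ (con (- 1ℚ) :* z :+ con 1ℚ :* z))) refl x y z

module MacWilliams {n : ℕ} (C : Code n) (sd : IsSelfDual C) where
  open SelfDual C sd

  macWilliams : ∀ x y z → W C (T₁ x y z) (T₂ x y z) (T₃ x y z) ≡ size * W C x y z
  macWilliams x y z = begin
    ΣV n (λ c → 𝟙 (C c) * prodT (weight (T₁ x y z) (T₂ x y z) (T₃ x y z)) c)
      ≡⟨ ΣV-cong n (λ c → cong (𝟙 (C c) *_) (trans (prodT-cong (transform-weight x y z) c) (fourier n t c))) ⟩
    ΣV n (λ c → 𝟙 (C c) * ΣV n (λ v → χ ⟨ c , v ⟩ * P v))
      ≡⟨ ΣV-cong n (λ c → sym (ΣV-* n (𝟙 (C c)) (λ v → χ ⟨ c , v ⟩ * P v))) ⟩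
    ΣV n (λ c → ΣV n (λ v → 𝟙 (C c) * (χ ⟨ c , v ⟩ * P v)))
      ≡⟨ ΣV-swap n n (λ c v → 𝟙 (C c) * (χ ⟨ c , v ⟩ * P v)) ⟩
    ΣV n (λ v → ΣV n (λ c → 𝟙 (C c) * (χ ⟨ c , v ⟩ * P v)))
      ≡⟨ ΣV-cong n (λ v → trans (ΣV-cong n (λ c → solve 3 (λ a b p → a :* (b :* p) := p :* (a :* b)) refl (𝟙 (C c)) (χ ⟨ c , v ⟩) (P v)))
                                (ΣV-* n (P v) (λ c → 𝟙 (C c) * χ ⟨ c , v ⟩))) ⟩
    ΣV n (λ v → P v * ΣV n (λ c → 𝟙 (C c) * χ ⟨ c , v ⟩))
      ≡⟨ ΣV-cong n (λ v → trans (cong (P v *_) (character-sum v))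
                               (solve 3 (λ p i k → p :* (i :* k) := k :* (i :* p)) refl (P v) (𝟙 (C v)) size)) ⟩
    ΣV n (λ v → size * (𝟙 (C v) * P v))
      ≡⟨ ΣV-* n size (λ v → 𝟙 (C v) * P v) ⟩
    size * W C x y z ∎
    where
    open ≡-Reasoning
    t : L → ℚ
    t = weight x y z
    P : Vec L n → ℚ
    P = prodT t

  -- only the zero vector contributes to W C x 0 0
  W-x00 : ∀ x → W C x 0ℚ 0ℚ ≡ x ^ n
  W-x00 x = trans (go n C) (trans (cong (λ b → 𝟙 b * x ^ n) (proj₁ (IsSelfDual.subgroup sd))) (ℚP.*-identityˡ _))
    where
    go : ∀ m (B : Vec L m → Bool) → ΣV m (λ v → 𝟙 (B v) * prodT (weight x 0ℚ 0ℚ) v) ≡ 𝟙 (B 0ᵛ) * x ^ m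
    go zero    B = refl
    go (suc m) B = begin
      ΣV m (λ w → 𝟙 (B (o ∷ w)) * (x * prodT (weight x 0ℚ 0ℚ) w)) + (Z e + (Z ω + Z ω̄))
        ≡⟨ cong₂ _+_ (trans (ΣV-cong m (λ w → solve 3 (λ a x p → a :* (x :* p) := x :* (a :* p)) refl
                                               (𝟙 (B (o ∷ w))) x (prodT (weight x 0ℚ 0ℚ) w)))
                            (trans (ΣV-* m x _) (cong (x *_) (go m (λ w → B (o ∷ w))))))
                     (cong₂ _+_ (Z≡0 e refl) (cong₂ _+_ (Z≡0 ω refl) (Z≡0 ω̄ refl))) ⟩
      x * (𝟙 (B (o ∷ 0ᵛ)) * x ^ m) + (0ℚ + (0ℚ + 0ℚ))
        ≡⟨ solve 3 (λ x a p → x :* (a :* p) :+ (con 0ℚ :+ (con 0ℚ :+ con 0ℚ)) := a :* (x :* p)) refl x (𝟙 (B (o ∷ 0ᵛ))) (x ^ m) ⟩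
      𝟙 (B 0ᵛ) * x ^ suc m ∎
      where
      open ≡-Reasoning
      Z : L → ℚ
      Z a = ΣV m (λ w → 𝟙 (B (a ∷ w)) * (weight x 0ℚ 0ℚ a * prodT (weight x 0ℚ 0ℚ) w))
      Z≡0 : ∀ a → weight x 0ℚ 0ℚ a ≡ 0ℚ → Z a ≡ 0ℚ
      Z≡0 a h = ΣV-0 m _ (λ w → trans (cong (λ u → 𝟙 (B (a ∷ w)) * (u * prodT (weight x 0ℚ 0ℚ) w)) h)
                  (solve 2 (λ i p → i :* (con 0ℚ :* p) := con 0ℚ) refl (𝟙 (B (a ∷ w))) (prodT (weight x 0ℚ 0ℚ) w)))

-- The size of a self-dual code: |C| = 2ⁿ.  MacWilliams at (1,1,1) gives
-- |C|·|C| = W(4,0,0) = 4ⁿ, and |C| ≥ 0.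

two : ℚ
two = 1ℚ + 1ℚ

^-nonneg : ∀ a k → 0ℚ ℚ.≤ a → 0ℚ ℚ.≤ a ^ k
^-nonneg a zero    a≥0 = ℚP.nonNegative⁻¹ 1ℚ
^-nonneg a (suc k) a≥0 = subst (ℚ._≤ a * a ^ k) (ℚP.*-zeroˡ (a ^ k))
  (ℚP.*-monoʳ-≤-nonNeg (a ^ k) {{ℚ.nonNegative (^-nonneg a k a≥0)}} a≥0)

smaller-square : ∀ a b → 0ℚ ℚ.≤ a → a ℚ.< b → a * a ℚ.< b * b
smaller-square a b a≥0 a<b = ℚP.≤-<-trans
  (ℚP.*-monoˡ-≤-nonNeg a {{ℚ.nonNegative a≥0}} (ℚP.<⇒≤ a<b))
  (ℚP.*-monoˡ-<-pos b {{ℚ.positive (ℚP.≤-<-trans a≥0 a<b)}} a<b)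

square-injective : ∀ a b → 0ℚ ℚ.≤ a → 0ℚ ℚ.≤ b → a * a ≡ b * b → a ≡ b
square-injective a b a≥0 b≥0 a²≡b² with ℚP.<-cmp a b
... | tri< a<b _ _ = ⊥-elim (ℚP.<-irrefl a²≡b² (smaller-square a b a≥0 a<b))
... | tri≈ _ a≡b _ = a≡b
... | tri> _ _ a>b = ⊥-elim (ℚP.<-irrefl (sym a²≡b²) (smaller-square b a b≥0 a>b))

prodT-ones : ∀ {n} (v : Vec L n) → prodT (weight 1ℚ 1ℚ 1ℚ) v ≡ 1ℚ
prodT-ones []       = refl
prodT-ones (o ∷ v)  = cong (1ℚ *_) (prodT-ones v)
prodT-ones (e ∷ v)  = cong (1ℚ *_) (prodT-ones v)
prodT-ones (ω ∷ v)  = cong (1ℚ *_) (prodT-ones v)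
prodT-ones (ω̄ ∷ v) = cong (1ℚ *_) (prodT-ones v)

module CodeSize {n : ℕ} (C : Code n) (sd : IsSelfDual C) where
  open SelfDual C sd
  open MacWilliams C sd

  size≡2ⁿ : size ≡ two ^ n
  size≡2ⁿ = square-injective size (two ^ n) size≥0 (^-nonneg two n (ℚP.nonNegative⁻¹ two)) (begin
    size * size                            ≡⟨ cong (size *_) (sym W-111) ⟩
    size * W C 1ℚ 1ℚ 1ℚ                    ≡⟨ sym (macWilliams 1ℚ 1ℚ 1ℚ) ⟩
    W C (two * two) 0ℚ 0ℚ                  ≡⟨ W-x00 (two * two) ⟩
    (two * two) ^ n                        ≡⟨ ^-* two two n ⟩
    two ^ n * two ^ n                      ∎)
    where
    open ≡-Reasoning
    size≥0 : 0ℚ ℚ.≤ size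
    size≥0 = ΣV-nonneg n _ λ v → 𝟙≥0 (C v)
      where
      𝟙≥0 : ∀ b → 0ℚ ℚ.≤ 𝟙 b
      𝟙≥0 true  = ℚP.nonNegative⁻¹ 1ℚ
      𝟙≥0 false = ℚP.≤-refl
    W-111 : W C 1ℚ 1ℚ 1ℚ ≡ size
    W-111 = ΣV-cong n (λ v → trans (cong (𝟙 (C v) *_) (prodT-ones v)) (ℚP.*-identityʳ _))

  macWilliams-2ⁿ : ∀ x y z → W C (T₁ x y z) (T₂ x y z) (T₃ x y z) ≡ two ^ n * W C x y z
  macWilliams-2ⁿ x y z = trans (macWilliams x y z) (cong (_* W C x y z) size≡2ⁿ)

-- Evenness: every codeword has an even number of coordinates equal to 1
-- (|x|² is odd only for x = 1), so W C x (−y) z = W C x y z.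

parity : ∀ {n} → Vec L n → Bool
parity []      = false
parity (a ∷ v) = q a xor parity v

bit : Bool → ℕ
bit true  = 1
bit false = 0

private
  odd-step : ∀ k → suc (1 ℕ.+ 2 ℕ.* k) ≡ 0 ℕ.+ 2 ℕ.* suc k
  odd-step = solve-∀
  two-step : ∀ b k → 2 ℕ.+ (b ℕ.+ 2 ℕ.* k) ≡ b ℕ.+ 2 ℕ.* suc k
  two-step = solve-∀

ewt-parity : ∀ {n} (v : Vec L n) → Σ ℕ λ k → ewt v ≡ bit (parity v) ℕ.+ 2 ℕ.* k
ewt-parity []      = 0 , refl
ewt-parity (o ∷ v) = ewt-parity v
ewt-parity (e ∷ v) with parity v | ewt-parity v
... | false | k , h = k , cong suc h
... | true  | k , h = suc k , trans (cong suc h) (odd-step k)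
ewt-parity (ω ∷ v) = let (k , h) = ewt-parity v in suc k , trans (cong (2 ℕ.+_) h) (two-step (bit (parity v)) k)
ewt-parity (ω̄ ∷ v) = let (k , h) = ewt-parity v in suc k , trans (cong (2 ℕ.+_) h) (two-step (bit (parity v)) k)

even⇒parity-false : ∀ {n} (v : Vec L n) → 2 ∣ ewt v → parity v ≡ false
even⇒parity-false v 2∣ewt with parity v | ewt-parity v
... | false | _     = refl
... | true  | k , h = ⊥-elim (odd (subst (2 ∣_) h 2∣ewt))
  where
  odd : ¬ (2 ∣ 1 ℕ.+ 2 ℕ.* k)
  odd 2∣1+2k with () ← ∣1⇒≡1 (∣m+n∣m⇒∣n (subst (2 ∣_) (ℕP.+-comm 1 (2 ℕ.* k)) 2∣1+2k) (m∣m*n k))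

*-exchange : ∀ a b c → a * (b * c) ≡ b * (a * c)
*-exchange = solve 3 (λ a b c → a :* (b :* c) := b :* (a :* c)) refl

prodT-negate : ∀ {n} x y z (v : Vec L n) → prodT (weight x (- y) z) v ≡ χ (parity v) * prodT (weight x y z) v
prodT-negate x y z []       = refl
prodT-negate x y z (o ∷ v)  = trans (cong (x *_) (prodT-negate x y z v)) (*-exchange x (χ (parity v)) _)
prodT-negate x y z (e ∷ v)  = trans (cong ((- y) *_) (prodT-negate x y z v)) (χ-flip (parity v))
  where
  χ-flip : ∀ p → (- y) * (χ p * prodT (weight x y z) v) ≡ χ (true xor p) * (y * prodT (weight x y z) v)
  χ-flip false = solve 2 (λ y t → (:- y) :* (con 1ℚ :* t) := con (- 1ℚ) :* (y :* t)) refl y (prodT (weight x y z) v)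
  χ-flip true  = solve 2 (λ y t → (:- y) :* (con (- 1ℚ) :* t) := con 1ℚ :* (y :* t)) refl y (prodT (weight x y z) v)
prodT-negate x y z (ω ∷ v)  = trans (cong (z *_) (prodT-negate x y z v)) (*-exchange z (χ (parity v)) _)
prodT-negate x y z (ω̄ ∷ v) = trans (cong (z *_) (prodT-negate x y z v)) (*-exchange z (χ (parity v)) _)

W-even : ∀ {n} (C : Code n) → IsEven C → ∀ x y z → W C x (- y) z ≡ W C x y z
W-even {n} C ev x y z = ΣV-cong n term
  where
  term : ∀ v → 𝟙 (C v) * prodT (weight x (- y) z) v ≡ 𝟙 (C v) * prodT (weight x y z) v
  term v with C v in v∈C
  ... | true  = cong (1ℚ *_) {prodT (weight x (- y) z) v} {prodT (weight x y z) v} (trans (prodT-negate x y z v)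
                 (trans (cong (λ p → χ p * prodT (weight x y z) v) (even⇒parity-false v (ev v v∈C)))
                        (ℚP.*-identityˡ (prodT (weight x y z) v))))
  ... | false = trans (ℚP.*-zeroˡ (prodT (weight x (- y) z) v)) (sym (ℚP.*-zeroˡ (prodT (weight x y z) v)))

enumerator : ∀ {n} → Code n → Poly3
enumerator C = map (λ c → (1ℚ , n₀ c , n₁ c , n₂ c)) (codewords C)

eval-enumerator : ∀ {n} (C : Code n) x y z → eval (enumerator C) x y z ≡ W C x y z
eval-enumerator C x y z = trans (go (codewords C)) (swe≡W C x y z)
  where
  go : ∀ {n} (cs : List (Vec L n)) → eval (map (λ c → (1ℚ , n₀ c , n₁ c , n₂ c)) cs) x y z ≡ sumMap (monomial x y z) cs
  go []       = refl
  go (c ∷ cs) = cong₂ _+_ (ℚP.*-identityˡ (monomial x y z c)) (go cs)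

counts : ∀ {n} (v : Vec L n) → n₀ v ℕ.+ n₁ v ℕ.+ n₂ v ≡ n
counts []       = refl
counts (o ∷ v)  = cong suc (counts v)
counts (e ∷ v)  = trans (cong (ℕ._+ n₂ v) (ℕP.+-suc (n₀ v) (n₁ v))) (cong suc (counts v))
counts (ω ∷ v)  = trans (ℕP.+-suc (n₀ v ℕ.+ n₁ v) (n₂ v)) (cong suc (counts v))
counts (ω̄ ∷ v) = trans (ℕP.+-suc (n₀ v ℕ.+ n₁ v) (n₂ v)) (cong suc (counts v))

Hom-enumerator : ∀ {n} (C : Code n) → Hom 0 n (enumerator C)
Hom-enumerator C = AllP.map⁺ (All.universal (λ c → trans (total (n₀ c) (n₁ c) (n₂ c)) (counts c)) (codewords C))
  where
  total : ∀ a b d → 1 ℕ.* a ℕ.+ 1 ℕ.* b ℕ.+ 1 ℕ.* d ≡ a ℕ.+ b ℕ.+ d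
  total = solve-∀

W-homogeneous : ∀ {n} (C : Code n) s x y z → W C (s * x) (s * y) (s * z) ≡ s ^ n * W C x y z
W-homogeneous {n} C s x y z = begin
  W C (s * x) (s * y) (s * z)                       ≡⟨ sym (eval-enumerator C _ _ _) ⟩
  eval (enumerator C) (s * x) (s * y) (s * z)       ≡⟨ eval-Hom-scale (enumerator C) (Hom-enumerator C) s x y z ⟩
  s ^ n * eval (enumerator C) x y z                 ≡⟨ cong (s ^ n *_) (eval-enumerator C x y z) ⟩
  s ^ n * W C x y z                                 ∎
  where open ≡-Reasoning

cancel-2ⁿ : ∀ n {p q} → two ^ n * p ≡ two ^ n * q → p ≡ q
cancel-2ⁿ n {p} {q} eq = begin
  p                          ≡⟨ sym (unit p) ⟩
  (½ ^ n * two ^ n) * p      ≡⟨ ℚP.*-assoc (½ ^ n) (two ^ n) p ⟩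
  ½ ^ n * (two ^ n * p)      ≡⟨ cong (½ ^ n *_) eq ⟩
  ½ ^ n * (two ^ n * q)      ≡⟨ sym (ℚP.*-assoc (½ ^ n) (two ^ n) q) ⟩
  (½ ^ n * two ^ n) * q      ≡⟨ unit q ⟩
  q                          ∎
  where
  open ≡-Reasoning
  one^ : ∀ k → 1ℚ ^ k ≡ 1ℚ
  one^ zero    = refl
  one^ (suc k) = trans (cong (1ℚ *_) (one^ k)) refl
  unit : ∀ r → (½ ^ n * two ^ n) * r ≡ r
  unit r = trans (cong (_* r) (trans (sym (^-* ½ two n)) (one^ n))) (ℚP.*-identityˡ r)

-- The change of variables  x = 2a + b + c,  y = b − c,  z = b + c.
-- It turns W C into a polynomial W' that is symmetric in a, b, c.

xOf yOf zOf : ℚ → ℚ → ℚ → ℚ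
xOf a b c = two * a + (b + c)
yOf a b c = b - c
zOf a b c = b + c

Aₚ Bₚ Cₚ : Poly3
Aₚ = (two , 1 , 0 , 0) ∷ (1ℚ , 0 , 1 , 0) ∷ (1ℚ , 0 , 0 , 1) ∷ []
Bₚ = (1ℚ , 0 , 1 , 0) ∷ (- 1ℚ , 0 , 0 , 1) ∷ []
Cₚ = (1ℚ , 0 , 1 , 0) ∷ (1ℚ , 0 , 0 , 1) ∷ []

module Gleason {n : ℕ} (C : Code n) (sd : IsSelfDual C) (ev : IsEven C) where
  open CodeSize C sd

  W' : Poly3
  W' = substP (enumerator C) Aₚ Bₚ Cₚ

  eval-W' : ∀ a b c → eval W' a b c ≡ W C (xOf a b c) (yOf a b c) (zOf a b c)
  eval-W' a b c = trans (eval-substP (enumerator C) Aₚ Bₚ Cₚ a b c) (trans (cong₃ (eval (enumerator C))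
      (solve 3 (λ a b c → ⟪ Aₚ ⟫ a b c := con two :* a :+ (b :+ c)) refl a b c)
      (solve 3 (λ a b c → ⟪ Bₚ ⟫ a b c := b :- c) refl a b c)
      (solve 3 (λ a b c → ⟪ Cₚ ⟫ a b c := b :+ c) refl a b c))
    (eval-enumerator C _ _ _))

  hW' : Hom 0 n W'
  hW' = WHomog-substP {1} {1} {1} (enumerator C) Aₚ Bₚ Cₚ (Hom-enumerator C)
          (refl ∷ refl ∷ refl ∷ []) (refl ∷ refl ∷ []) (refl ∷ refl ∷ [])

  -- exchanging b and c negates y: symmetry from evenness
  W'-swap₂₃ : ∀ a b c → eval W' a b c ≡ eval W' a c b
  W'-swap₂₃ a b c = trans (eval-W' a b c) (trans (sym (W-even C ev _ _ _)) (trans (cong₃ (W C)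
       (solve 3 (λ a b c → con two :* a :+ (b :+ c) := con two :* a :+ (c :+ b)) refl a b c)
       (solve 2 (λ b c → :- (b :- c) := c :- b) refl b c)
       (ℚP.+-comm b c)) (sym (eval-W' a c b))))

  -- exchanging a and b is the MacWilliams transform, up to the factor 2
  W'-swap₁₂ : ∀ a b c → eval W' a b c ≡ eval W' b a c
  W'-swap₁₂ a b c = trans (eval-W' a b c) (trans (cancel-2ⁿ n (begin
    two ^ n * W C (xOf a b c) (yOf a b c) (zOf a b c)
      ≡⟨ sym (W-homogeneous C two _ _ _) ⟩
    W C (two * xOf a b c) (two * yOf a b c) (two * zOf a b c)
      ≡⟨ cong₃ (W C)
          (solve 3 (λ a b c → con two :* (con two :* a :+ (b :+ c)) := (con two :* b :+ (a :+ c)) :+ ((a :- c) :+ ((a :+ c) :+ (a :+ c)))) refl a b c)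
          (solve 3 (λ a b c → con two :* (b :- c) := (con two :* b :+ (a :+ c)) :+ ((a :- c) :+ :- ((a :+ c) :+ (a :+ c)))) refl a b c)
          (solve 3 (λ a b c → con two :* (b :+ c) := (con two :* b :+ (a :+ c)) :+ :- (a :- c)) refl a b c) ⟩
    W C (T₁ (xOf b a c) (yOf b a c) (zOf b a c)) (T₂ (xOf b a c) (yOf b a c) (zOf b a c)) (T₃ (xOf b a c) (yOf b a c) (zOf b a c))
      ≡⟨ macWilliams-2ⁿ _ _ _ ⟩
    two ^ n * W C (xOf b a c) (yOf b a c) (zOf b a c) ∎)) (sym (eval-W' b a c)))
    where open ≡-Reasoning

  swe-via-W' : ∀ x y z → swe C x y z ≡ eval W' (½ * (x - z)) (½ * (y + z)) (½ * (z - y))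
  swe-via-W' x y z = trans (swe≡W C x y z) (trans (cong₃ (W C)
      (solve 3 (λ x y z → x := con two :* (con ½ :* (x :- z)) :+ (con ½ :* (y :+ z) :+ con ½ :* (z :- y))) refl x y z)
      (solve 3 (λ x y z → y := con ½ :* (y :+ z) :- con ½ :* (z :- y)) refl x y z)
      (solve 3 (λ x y z → z := con ½ :* (y :+ z) :+ con ½ :* (z :- y)) refl x y z))
    (sym (eval-W' _ _ _)))

g₁ g₂ g₃ : ℚ → ℚ → ℚ → ℚ
g₁ x y z = x + z
g₂ x y z = (x ^ 2) + ((y ^ 2) + (fromℕ 2 * (z ^ 2)))
g₃ x y z = (x ^ 3) + ((fromℕ 3 * (x * (z ^ 2))) + ((fromℕ 3 * ((y ^ 2) * z)) + (z ^ 3)))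

F₁ F₂ F₃ : Poly3
F₁ = (½ , 1 , 0 , 0) ∷ []
F₂ = (ℤ.+ 1 ℚ./ 4 , 2 , 0 , 0) ∷ (- (ℤ.+ 1 ℚ./ 4) , 0 , 1 , 0) ∷ []
F₃ = (ℤ.+ 1 ℚ./ 24 , 3 , 0 , 0) ∷ (- (ℤ.+ 1 ℚ./ 8) , 1 , 1 , 0) ∷ (ℤ.+ 1 ℚ./ 12 , 0 , 0 , 1) ∷ []

module Inverse (x y z : ℚ) where
  a b c : ℚ
  a = ½ * (x - z)
  b = ½ * (y + z)
  c = ½ * (z - y)

  private
    A B C G₁ G₂ G₃ : ∀ {m} → Polynomial m → Polynomial m → Polynomial m → Polynomial m
    A x y z = con ½ :* (x :- z)
    B x y z = con ½ :* (y :+ z)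
    C x y z = con ½ :* (z :- y)
    G₁ x y z = x :+ z
    G₂ x y z = (x :^ 2) :+ ((y :^ 2) :+ (con (fromℕ 2) :* (z :^ 2)))
    G₃ x y z = (x :^ 3) :+ ((con (fromℕ 3) :* (x :* (z :^ 2))) :+ ((con (fromℕ 3) :* ((y :^ 2) :* z)) :+ (z :^ 3)))

  e₁-via-g : e₁ a b c ≡ eval F₁ (g₁ x y z) (g₂ x y z) (g₃ x y z)
  e₁-via-g = solve 3 (λ x y z → A x y z :+ (B x y z :+ C x y z) := ⟪ F₁ ⟫ (G₁ x y z) (G₂ x y z) (G₃ x y z)) refl x y z

  e₂-via-g : e₂ a b c ≡ eval F₂ (g₁ x y z) (g₂ x y z) (g₃ x y z)
  e₂-via-g = solve 3 (λ x y z → A x y z :* B x y z :+ (A x y z :* C x y z :+ B x y z :* C x y z)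
                               := ⟪ F₂ ⟫ (G₁ x y z) (G₂ x y z) (G₃ x y z)) refl x y z

  e₃-via-g : e₃ a b c ≡ eval F₃ (g₁ x y z) (g₂ x y z) (g₃ x y z)
  e₃-via-g = solve 3 (λ x y z → A x y z :* (B x y z :* C x y z) := ⟪ F₃ ⟫ (G₁ x y z) (G₂ x y z) (G₃ x y z)) refl x y z

toWeightedHomogeneous : ∀ {n} F → WHomog 1 2 3 n F → WeightedHomogeneous n F
toWeightedHomogeneous F = All.map (λ { {(_ , a , b , d)} h → trans (cong (λ u → u ℕ.+ 2 ℕ.* b ℕ.+ 3 ℕ.* d) (sym (ℕP.*-identityˡ a))) h })

theorem4p3 : (n : ℕ) (C : Code n) → IsSelfDual C → IsEven C →
    Σ Poly3 (λ F → WeightedHomogeneous n F ×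
      (∀ (x y z : ℚ) → swe C x y z ≡
        eval F (x + z)
               ((x ^ 2) + ((y ^ 2) + (fromℕ 2 * (z ^ 2))))
               ((x ^ 3) + ((fromℕ 3 * (x * (z ^ 2))) + ((fromℕ 3 * ((y ^ 2) * z)) + (z ^ 3))))))
theorem4p3 n C sd ev =
  let (G , hG , W'≡G) = elementary₃ n W' hW' W'-swap₁₂ W'-swap₂₃
  in substP G F₁ F₂ F₃ ,
     toWeightedHomogeneous _ (WHomog-substP {1} {2} {3} G F₁ F₂ F₃ hG (refl ∷ []) (refl ∷ refl ∷ []) (refl ∷ refl ∷ refl ∷ [])) ,
     λ x y z → let open Inverse x y z in begin
       swe C x y z                                          ≡⟨ swe-via-W' x y z ⟩
       eval W' a b c                                        ≡⟨ W'≡G a b c ⟩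
       eval G (e₁ a b c) (e₂ a b c) (e₃ a b c)              ≡⟨ cong₃ (eval G) e₁-via-g e₂-via-g e₃-via-g ⟩
       eval G (eval F₁ (g₁ x y z) (g₂ x y z) (g₃ x y z)) (eval F₂ (g₁ x y z) (g₂ x y z) (g₃ x y z))
              (eval F₃ (g₁ x y z) (g₂ x y z) (g₃ x y z))    ≡⟨ sym (eval-substP G F₁ F₂ F₃ _ _ _) ⟩
       eval (substP G F₁ F₂ F₃) (g₁ x y z) (g₂ x y z) (g₃ x y z) ∎
  where
  open Gleason C sd ev
  open ≡-Reasoning
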